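{- Let $F_1,F_2$ be rooted forests. Then $P_{F_1}=P_{F_2}$ if and only if $F_1\cong F_2$ (as rooted forests). Likewise, $S_{F_1}=S_{F_2}$ if and only if $F_1\cong F_2$. In other words, $P$ and $S$ are complete invariants for rooted forests.
   Context: A rooted tree is a finite tree with one distinguished vertex, its root. A rooted forest is a finite, possibly empty, disjoint union of rooted trees. An isomorphism of rooted forests is a graph isomorphism mapping roots to roots. A vertex is a leaf of a rooted forest if it has no children (an isolated vertex is both a root and a leaf). A leaf-induced subforest $F'$ of a rooted forest $F$ is a (possibly empty) union of paths each connecting the root of a component of $F$ to a leaf of $F$ in that component; equivalently $F'$ is determined by a subset of the leaves of $F$, each chosen leaf being joined to the root of its component. Define $P_F(x,y)=\sum_{F'} x^{|V(F')|}y^{|L(F')|}$, the sum over all leaf-induced subforests $F'$ of $F$, where $V(F')$, $L(F')$ are the vertex and leaf sets of $F'$. For a rooted tree $T$, a subtree is either the empty subgraph or a connected subgraph containing the root; it is identified with its vertex set. For a vertex set $S$, the boundary $\partial S$ is the set of vertices adjacent to some vertex of $S$ but not in $S$, with the convention $\partial\emptyset=\{\text{root}\}$. Define $S_T(x,y)=\sum_{T'} x^{|T'|}y^{|\partial T'|}$, the sum over all subtrees $T'$ of $T$. For a rooted forest $F$ with components $T_1,\dots,T_r$, set $S_F=\prod_{i=1}^r S_{T_i}$ (so $S$ of the empty forest is $1$). -}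

module Defs where

open import Data.Nat using (ℕ; zero; suc; _+_; _≟_)
open import Data.Bool using (Bool; true; false; if_then_else_; _∧_)
open import Data.List using (List; []; _∷_; map; concatMap)
open import Data.Product using (_×_; _,_)
open import Relation.Nullary.Decidable using (⌊_⌋)
open import Relation.Binary.PropositionalEquality using (_≡_)
open import Data.List.Relation.Binary.Permutation.Homogeneous using (Permutation)

-- Rooted trees (unordered in meaning; isomorphism below ignores order of children).
-- A tree is a root together with the forest of subtrees hanging from its children.
data Tree : Set where
  node : List Tree → Tree

Forest : Set
Forest = List Tree

data _≅T_ : Tree → Tree → Set where
  node : ∀ {cs ds} → Permutation _≅T_ cs ds → node cs ≅T node ds

_≅F_ : Forest → Forest → Set
F₁ ≅F F₂ = Permutation _≅T_ F₁ F₂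

-- Bivariate polynomials with ℕ coefficients, represented as a list of monomials
-- (a , b) standing for x^a y^b; the polynomial is the sum of its monomials.
Poly : Set
Poly = List (ℕ × ℕ)

coeff : Poly → ℕ → ℕ → ℕ
coeff [] i j = 0
coeff ((a , b) ∷ p) i j = (if ⌊ a ≟ i ⌋ ∧ ⌊ b ≟ j ⌋ then 1 else 0) + coeff p i j

_≈P_ : Poly → Poly → Set
p ≈P q = ∀ i j → coeff p i j ≡ coeff q i j

one : Poly
one = (0 , 0) ∷ []

mul : Poly → Poly → Poly
mul p q = concatMap (λ { (a , b) → map (λ { (c , d) → (a + c , b + d) }) q }) p

-- P: one monomial x^|V(F')| y^|L(F')| for each subset of the leaves of the forest.
-- For a tree, a leaf subset is a leaf subset in each child subtree; the root belongs
-- to F' iff at least one leaf is chosen.  An isolated vertex is a leaf: not chosen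
-- (x^0 y^0) or chosen (x^1 y^1).  For a forest, choices are independent per component.
rootIfLeaf : ℕ × ℕ → ℕ × ℕ
rootIfLeaf (v , zero) = (v , zero)
rootIfLeaf (v , suc l) = (suc v , suc l)

mutual
  PT : Tree → Poly
  PT (node []) = (0 , 0) ∷ (1 , 1) ∷ []
  PT (node (c ∷ cs)) = map rootIfLeaf (PF (c ∷ cs))

  PF : Forest → Poly
  PF [] = one
  PF (t ∷ ts) = mul (PT t) (PF ts)

-- S: one monomial x^|T'| y^|∂T'| for each subtree T' (empty, or connected containing
-- the root).  The empty subtree has boundary {root}: x^0 y^1.  A nonempty subtree
-- contains the root and, for each child c, either excludes c (c is then a boundary
-- vertex, x^0 y^1) or contains a nonempty subtree rooted at c; these options are
-- exactly the monomials of S_c.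
mutual
  ST : Tree → Poly
  ST (node cs) = (0 , 1) ∷ map (λ { (v , b) → (suc v , b) }) (SFo cs)

  SFo : Forest → Poly
  SFo [] = one
  SFo (t ∷ ts) = mul (ST t) (SFo ts)

module Submission where

-- S and P are multiplicative over the trees of a forest, and the polynomial of a
-- tree determines that of its forest of children, so by induction on size it
-- suffices to find in F₂ a tree with the same polynomial as some tree T of F₁ and
-- cancel it.  Take T heaviest in F₁ ∪ F₂ (most vertices for S, most leaves for P).
-- By Hensel's lemma in ℚ[[t]] its polynomial vanishes at a power-series point:
-- x = t, y = -t^|T| + ⋯ for S, and x = 1 - σ(t), y = t - 1 with σ of order ℓ(T)
-- for P (as P_T(1, y) = (1 + y)^ℓ(T)).  Being a domain, ℚ[[t]] forces some tree
-- T′ of F₂ to vanish there too; as T′ is no heavier than T, evaluation at that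
-- point is injective on the terms below the leading monomials, so S_T′ = S_T
-- (resp. P_T′ = P_T).

open import Defs
open import Data.Product using (_×_; _,_)
open import Function.Bundles using (_⇔_)

module PowerSeries where

  open import Algebra.Bundles using (CommutativeRing)
  import Algebra.Properties.Group as GroupProperties
  import Algebra.Solver.Ring.NaturalCoefficients.Default as NaturalCoefficientsSolver
  open import Data.Empty using (⊥-elim)
  open import Data.Nat using (ℕ; zero; suc; _+_; _≟_)
  import Data.Nat.Properties as ℕ
  open import Data.Product using (_,_)
  open import Data.Rational as ℚ using (ℚ; 0ℚ; 1ℚ)
  import Data.Rational.Properties as ℚ
  open import Data.Rational.Solver using (module +-*-Solver)
  open import Relation.Binary.PropositionalEquality
  open import Relation.Nullary using (yes; no)
  open import Relation.Nullary.Decidable using (⌊_⌋; toWitness)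
  open import Data.Bool using (if_then_else_)

  Series : Set
  Series = ℕ → ℚ

  infix 4 _≈_
  _≈_ : Series → Series → Set
  A ≈ B = ∀ i → A i ≡ B i

  ≈-refl : ∀ {A} → A ≈ A
  ≈-refl i = refl

  ≈-sym : ∀ {A B} → A ≈ B → B ≈ A
  ≈-sym e i = sym (e i)

  ≈-trans : ∀ {A B C} → A ≈ B → B ≈ C → A ≈ C
  ≈-trans e f i = trans (e i) (f i)

  0S : Series
  0S _ = 0ℚ

  1S : Series
  1S zero = 1ℚ
  1S (suc _) = 0ℚ

  infixl 6 _⊕_
  infixl 7 _⊛_
  infixr 8 _·_

  _⊕_ : Series → Series → Series
  (A ⊕ B) i = A i ℚ.+ B i

  ⊝_ : Series → Series
  (⊝ A) i = ℚ.- A i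

  _·_ : ℚ → Series → Series
  (c · A) i = c ℚ.* A i

  shift : Series → Series
  shift A zero = 0ℚ
  shift A (suc i) = A i

  shift-cong : ∀ {A B} → A ≈ B → shift A ≈ shift B
  shift-cong e zero = refl
  shift-cong e (suc i) = e i

  tail : Series → Series
  tail A i = A (suc i)

  _⊛_ : Series → Series → Series
  (A ⊛ B) zero = A 0 ℚ.* B 0
  (A ⊛ B) (suc k) = A 0 ℚ.* B (suc k) ℚ.+ (tail A ⊛ B) k

  open +-*-Solver

  ⊛-unfold : ∀ A B → A ⊛ B ≈ A 0 · B ⊕ shift (tail A ⊛ B)
  ⊛-unfold A B zero = sym (ℚ.+-identityʳ _)
  ⊛-unfold A B (suc k) = refl

  ⊕-cong : ∀ {A A′ B B′} → A ≈ A′ → B ≈ B′ → A ⊕ B ≈ A′ ⊕ B′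
  ⊕-cong eA eB i = cong₂ ℚ._+_ (eA i) (eB i)

  ⊕-congˡ : ∀ A {B B′} → B ≈ B′ → A ⊕ B ≈ A ⊕ B′
  ⊕-congˡ A e i = cong (A i ℚ.+_) (e i)

  ⊕-congʳ : ∀ B {A A′} → A ≈ A′ → A ⊕ B ≈ A′ ⊕ B
  ⊕-congʳ B e i = cong (ℚ._+ B i) (e i)

  ⊝-cong : ∀ {A A′} → A ≈ A′ → ⊝ A ≈ ⊝ A′
  ⊝-cong eA i = cong ℚ.-_ (eA i)

  ⊛-cong : ∀ {A A′ B B′} → A ≈ A′ → B ≈ B′ → A ⊛ B ≈ A′ ⊛ B′
  ⊛-cong eA eB zero = cong₂ ℚ._*_ (eA 0) (eB 0)
  ⊛-cong eA eB (suc k) =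
    cong₂ ℚ._+_ (cong₂ ℚ._*_ (eA 0) (eB (suc k))) (⊛-cong (λ i → eA (suc i)) eB k)

  ⊛-congˡ : ∀ A {B B′} → B ≈ B′ → A ⊛ B ≈ A ⊛ B′
  ⊛-congˡ A = ⊛-cong (≈-refl {A})

  ⊛-congʳ : ∀ B {A A′} → A ≈ A′ → A ⊛ B ≈ A′ ⊛ B
  ⊛-congʳ B e = ⊛-cong e (≈-refl {B})

  ⊛-zeroˡ : ∀ B → 0S ⊛ B ≈ 0S
  ⊛-zeroˡ B zero = ℚ.*-zeroˡ (B 0)
  ⊛-zeroˡ B (suc k) =
    trans (cong₂ ℚ._+_ (ℚ.*-zeroˡ (B (suc k))) (⊛-zeroˡ B k)) (ℚ.+-identityˡ 0ℚ)

  ⊛-identityˡ : ∀ B → 1S ⊛ B ≈ B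
  ⊛-identityˡ B zero = ℚ.*-identityˡ (B 0)
  ⊛-identityˡ B (suc k) =
    trans (cong₂ ℚ._+_ (ℚ.*-identityˡ (B (suc k))) (⊛-zeroˡ B k)) (ℚ.+-identityʳ _)

  ⊛-distribʳ : ∀ A B C → (A ⊕ B) ⊛ C ≈ A ⊛ C ⊕ B ⊛ C
  ⊛-distribʳ A B C zero = ℚ.*-distribʳ-+ (C 0) (A 0) (B 0)
  ⊛-distribʳ A B C (suc k) =
    trans (cong ((A 0 ℚ.+ B 0) ℚ.* C (suc k) ℚ.+_) (⊛-distribʳ (tail A) (tail B) C k))
          (solve 5 (λ a b c x y → (a :+ b) :* c :+ (x :+ y) := (a :* c :+ x) :+ (b :* c :+ y))
                 refl (A 0) (B 0) (C (suc k)) ((tail A ⊛ C) k) ((tail B ⊛ C) k))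

  ⊛-distribˡ : ∀ A B C → A ⊛ (B ⊕ C) ≈ A ⊛ B ⊕ A ⊛ C
  ⊛-distribˡ A B C zero = ℚ.*-distribˡ-+ (A 0) (B 0) (C 0)
  ⊛-distribˡ A B C (suc k) =
    trans (cong (A 0 ℚ.* (B (suc k) ℚ.+ C (suc k)) ℚ.+_) (⊛-distribˡ (tail A) B C k))
          (solve 5 (λ a b c x y → a :* (b :+ c) :+ (x :+ y) := (a :* b :+ x) :+ (a :* c :+ y))
                 refl (A 0) (B (suc k)) (C (suc k)) ((tail A ⊛ B) k) ((tail A ⊛ C) k))

  ⊛-scalarˡ : ∀ c A B → (c · A) ⊛ B ≈ c · (A ⊛ B)
  ⊛-scalarˡ c A B zero = ℚ.*-assoc c (A 0) (B 0)
  ⊛-scalarˡ c A B (suc k) =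
    trans (cong (c ℚ.* A 0 ℚ.* B (suc k) ℚ.+_) (⊛-scalarˡ c (tail A) B k))
          (solve 4 (λ c a b x → c :* a :* b :+ c :* x := c :* (a :* b :+ x))
                 refl c (A 0) (B (suc k)) ((tail A ⊛ B) k))

  ⊛-comm : ∀ A B → A ⊛ B ≈ B ⊛ A
  ⊛-comm A B zero = ℚ.*-comm (A 0) (B 0)
  ⊛-comm A B (suc zero) =
    solve 4 (λ a b c d → a :* b :+ c :* d := d :* c :+ b :* a) refl (A 0) (B 1) (A 1) (B 0)
  ⊛-comm A B (suc (suc k)) = begin
      A 0 ℚ.* B (2 + k) ℚ.+ (tail A ⊛ B) (suc k)
    ≡⟨ cong (A 0 ℚ.* B (2 + k) ℚ.+_) (⊛-comm (tail A) B (suc k)) ⟩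
      A 0 ℚ.* B (2 + k) ℚ.+ (B 0 ℚ.* A (2 + k) ℚ.+ (tail B ⊛ tail A) k)
    ≡⟨ cong (λ z → A 0 ℚ.* B (2 + k) ℚ.+ (B 0 ℚ.* A (2 + k) ℚ.+ z)) (⊛-comm (tail B) (tail A) k) ⟩
      A 0 ℚ.* B (2 + k) ℚ.+ (B 0 ℚ.* A (2 + k) ℚ.+ (tail A ⊛ tail B) k)
    ≡⟨ solve 5 (λ a b c d x → a :* b :+ (c :* d :+ x) := c :* d :+ (a :* b :+ x))
             refl (A 0) (B (2 + k)) (B 0) (A (2 + k)) ((tail A ⊛ tail B) k) ⟩
      B 0 ℚ.* A (2 + k) ℚ.+ (A 0 ℚ.* B (2 + k) ℚ.+ (tail A ⊛ tail B) k)
    ≡⟨ cong (B 0 ℚ.* A (2 + k) ℚ.+_) (⊛-comm A (tail B) (suc k)) ⟩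
      B 0 ℚ.* A (2 + k) ℚ.+ (tail B ⊛ A) (suc k) ∎
    where open ≡-Reasoning

  ⊛-shiftˡ : ∀ A B → shift A ⊛ B ≈ shift (A ⊛ B)
  ⊛-shiftˡ A B zero = ℚ.*-zeroˡ (B 0)
  ⊛-shiftˡ A B (suc k) =
    trans (cong (ℚ._+ (A ⊛ B) k) (ℚ.*-zeroˡ (B (suc k)))) (ℚ.+-identityˡ _)

  ⊛-assoc : ∀ A B C → (A ⊛ B) ⊛ C ≈ A ⊛ (B ⊛ C)
  ⊛-assoc A B C k = begin
      ((A ⊛ B) ⊛ C) k
    ≡⟨ ⊛-cong (⊛-unfold A B) ≈-refl k ⟩
      ((A 0 · B ⊕ shift (tail A ⊛ B)) ⊛ C) k
    ≡⟨ ⊛-distribʳ (A 0 · B) (shift (tail A ⊛ B)) C k ⟩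
      ((A 0 · B) ⊛ C) k ℚ.+ (shift (tail A ⊛ B) ⊛ C) k
    ≡⟨ cong₂ ℚ._+_ (⊛-scalarˡ (A 0) B C k) (⊛-shiftˡ (tail A ⊛ B) C k) ⟩
      A 0 ℚ.* (B ⊛ C) k ℚ.+ shift ((tail A ⊛ B) ⊛ C) k
    ≡⟨ cong (A 0 ℚ.* (B ⊛ C) k ℚ.+_) (shifted k) ⟩
      A 0 ℚ.* (B ⊛ C) k ℚ.+ shift (tail A ⊛ (B ⊛ C)) k
    ≡⟨ ⊛-unfold A (B ⊛ C) k ⟨
      (A ⊛ (B ⊛ C)) k ∎
    where
    open ≡-Reasoning
    shifted : shift ((tail A ⊛ B) ⊛ C) ≈ shift (tail A ⊛ (B ⊛ C))
    shifted zero = refl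
    shifted (suc k) = ⊛-assoc (tail A) B C k

  ring : CommutativeRing _ _
  ring = record
    { Carrier = Series
    ; _≈_ = _≈_
    ; _+_ = _⊕_
    ; _*_ = _⊛_
    ; -_ = ⊝_
    ; 0# = 0S
    ; 1# = 1S
    ; isCommutativeRing = record
      { isRing = record
        { +-isAbelianGroup = record
          { isGroup = record
            { isMonoid = record
              { isSemigroup = record
                { isMagma = record
                  { isEquivalence = record { refl = ≈-refl ; sym = ≈-sym ; trans = ≈-trans }
                  ; ∙-cong = ⊕-cong }
                ; assoc = λ A B C i → ℚ.+-assoc (A i) (B i) (C i) }
              ; identity = (λ A i → ℚ.+-identityˡ (A i)) , (λ A i → ℚ.+-identityʳ (A i)) }
            ; inverse = (λ A i → ℚ.+-inverseˡ (A i)) , (λ A i → ℚ.+-inverseʳ (A i))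
            ; ⁻¹-cong = ⊝-cong }
          ; comm = λ A B i → ℚ.+-comm (A i) (B i) }
        ; *-cong = ⊛-cong
        ; *-assoc = ⊛-assoc
        ; *-identity = ⊛-identityˡ , λ A → ≈-trans (⊛-comm A 1S) (⊛-identityˡ A)
        ; distrib = ⊛-distribˡ , λ A B C → ⊛-distribʳ B C A }
      ; *-comm = ⊛-comm }
    }

  ⊛-identityʳ : ∀ A → A ⊛ 1S ≈ A
  ⊛-identityʳ = CommutativeRing.*-identityʳ ring

  ⊛-zeroʳ : ∀ A → A ⊛ 0S ≈ 0S
  ⊛-zeroʳ = CommutativeRing.zeroʳ ring

  open GroupProperties (CommutativeRing.+-group ring) public
    using () renaming (∙-cancelˡ to ⊕-cancelˡ; ∙-cancelʳ to ⊕-cancelʳ)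

  module SeriesSolver = NaturalCoefficientsSolver (CommutativeRing.commutativeSemiring ring)

  open import Algebra.Properties.Semiring.Exp (CommutativeRing.semiring ring) public
    using (_^_; ^-congˡ; ^-homo-*; ^-assocʳ)

  𝕥 : Series
  𝕥 = shift 1S

  𝕥⊛ : ∀ A → 𝕥 ⊛ A ≈ shift A
  𝕥⊛ A = ≈-trans (⊛-shiftˡ 1S A) (shift-cong (⊛-identityˡ A))

  δ : ℕ → ℕ → ℕ
  δ m n = if ⌊ m ≟ n ⌋ then 1 else 0

  δ-diag : ∀ n → δ n n ≡ 1
  δ-diag n with n ≟ n
  ... | yes _ = refl
  ... | no n≢n = ⊥-elim (n≢n refl)

  δ-off : ∀ {m n} → m ≢ n → δ m n ≡ 0
  δ-off {m} {n} m≢n with m ≟ n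
  ... | yes m≡n = ⊥-elim (m≢n m≡n)
  ... | no _ = refl

  δ-suc : ∀ m n → δ (suc m) (suc n) ≡ δ m n
  δ-suc m n with m ≟ n
  ... | yes refl = δ-diag (suc m)
  ... | no m≢n = δ-off (λ e → m≢n (ℕ.suc-injective e))

  fromℕ : ℕ → ℚ
  fromℕ zero = 0ℚ
  fromℕ (suc n) = 1ℚ ℚ.+ fromℕ n

  fromℕ-+ : ∀ m n → fromℕ (m + n) ≡ fromℕ m ℚ.+ fromℕ n
  fromℕ-+ zero n = sym (ℚ.+-identityˡ (fromℕ n))
  fromℕ-+ (suc m) n = trans (cong (1ℚ ℚ.+_) (fromℕ-+ m n)) (sym (ℚ.+-assoc 1ℚ (fromℕ m) (fromℕ n)))

  fromℕ-suc-positive : ∀ n → 0ℚ ℚ.< fromℕ (suc n)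
  fromℕ-suc-positive n = ℚ.<-≤-trans 0<1 (ℚ.≤-trans (ℚ.≤-reflexive (sym (ℚ.+-identityʳ 1ℚ)))
                                                   (ℚ.+-monoʳ-≤ 1ℚ (nonnegative n)))
    where
    0<1 : 0ℚ ℚ.< 1ℚ
    0<1 = toWitness {a? = 0ℚ ℚ.<? 1ℚ} _
    nonnegative : ∀ n → 0ℚ ℚ.≤ fromℕ n
    nonnegative zero = ℚ.≤-refl
    nonnegative (suc n) = ℚ.<⇒≤ (fromℕ-suc-positive n)

  fromℕ-suc≢0 : ∀ n → fromℕ (suc n) ≢ 0ℚ
  fromℕ-suc≢0 n e = ℚ.<⇒≢ (fromℕ-suc-positive n) (sym e)

  fromℕ-injective : ∀ {m n} → fromℕ m ≡ fromℕ n → m ≡ n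
  fromℕ-injective {zero} {zero} e = refl
  fromℕ-injective {zero} {suc n} e = ⊥-elim (fromℕ-suc≢0 n (sym e))
  fromℕ-injective {suc m} {zero} e = ⊥-elim (fromℕ-suc≢0 m e)
  fromℕ-injective {suc m} {suc n} e = cong suc (fromℕ-injective (ℚ-cancelˡ 1ℚ (fromℕ m) (fromℕ n) e))
    where open GroupProperties ℚ.+-0-group using () renaming (∙-cancelˡ to ℚ-cancelˡ)

  𝕥^-coeff : ∀ n i → (𝕥 ^ n) i ≡ fromℕ (δ n i)
  𝕥^-coeff zero zero = sym (ℚ.+-identityʳ 1ℚ)
  𝕥^-coeff zero (suc i) = refl
  𝕥^-coeff (suc n) zero = 𝕥⊛ (𝕥 ^ n) zero
  𝕥^-coeff (suc n) (suc i) =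
    trans (𝕥⊛ (𝕥 ^ n) (suc i)) (trans (𝕥^-coeff n i) (cong fromℕ (sym (δ-suc n i))))

module Truncation where

  open import Algebra.Bundles using (CommutativeRing)
  open import Data.Empty using (⊥-elim)
  open import Data.Nat using (ℕ; zero; suc; _+_; _<_; _≤_; z≤n; s≤s; _≟_)
  import Data.Nat.Properties as ℕ
  open import Data.Product using (_×_; _,_; proj₁; proj₂)
  open import Data.Rational as ℚ using (ℚ; 0ℚ; 1ℚ)
  import Data.Rational.Properties as ℚ
  open import Data.Rational.Solver using (module +-*-Solver)
  open import Data.Sum using (inj₁; inj₂)
  open import Relation.Binary.PropositionalEquality
  open import Relation.Nullary using (¬_; yes; no)
  open PowerSeries

  open +-*-Solver

  infix 4 _≈[_]_
  _≈[_]_ : Series → ℕ → Series → Set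
  A ≈[ k ] B = ∀ i → i < k → A i ≡ B i

  ≈[]-trans : ∀ {k A B C} → A ≈[ k ] B → B ≈[ k ] C → A ≈[ k ] C
  ≈[]-trans e f i i<k = trans (e i i<k) (f i i<k)

  ≈[]-weaken : ∀ {k k′ A B} → k ≤ k′ → A ≈[ k′ ] B → A ≈[ k ] B
  ≈[]-weaken k≤k′ e i i<k = e i (ℕ.<-≤-trans i<k k≤k′)

  ≈[]-tail : ∀ {k A B} → A ≈[ suc k ] B → tail A ≈[ k ] tail B
  ≈[]-tail e i i<k = e (suc i) (s≤s i<k)

  ≈[]-extend : ∀ {n A B} → A ≈[ n ] B → A n ≡ B n → A ≈[ suc n ] B
  ≈[]-extend {n} e eₙ i i<1+n with ℕ.m≤n⇒m<n∨m≡n (ℕ.≤-pred i<1+n)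
  ... | inj₁ i<n = e i i<n
  ... | inj₂ refl = eₙ

  ⊛-cong-≈[] : ∀ {n A A′ B B′} → A ≈[ n ] A′ → B ≈[ n ] B′ → A ⊛ B ≈[ n ] A′ ⊛ B′
  ⊛-cong-≈[] {suc n} eA eB zero _ = cong₂ ℚ._*_ (eA 0 (s≤s z≤n)) (eB 0 (s≤s z≤n))
  ⊛-cong-≈[] {suc n} eA eB (suc i) (s≤s i<n) =
    cong₂ ℚ._+_ (cong₂ ℚ._*_ (eA 0 (s≤s z≤n)) (eB (suc i) (s≤s i<n)))
                (⊛-cong-≈[] (≈[]-tail eA) (≈[]-weaken (ℕ.n≤1+n n) eB) i i<n)

  ⊛-head-zeroˡ : ∀ {A} B → A 0 ≡ 0ℚ → A ⊛ B ≈ shift (tail A ⊛ B)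
  ⊛-head-zeroˡ {A} B A₀≡0 zero = trans (cong (ℚ._* B 0) A₀≡0) (ℚ.*-zeroˡ (B 0))
  ⊛-head-zeroˡ {A} B A₀≡0 (suc k) =
    trans (cong (λ z → z ℚ.* B (suc k) ℚ.+ (tail A ⊛ B) k) A₀≡0)
          (trans (cong (ℚ._+ (tail A ⊛ B) k) (ℚ.*-zeroˡ (B (suc k)))) (ℚ.+-identityˡ _))

  ⊛-head-zeroʳ : ∀ A {B} → B 0 ≡ 0ℚ → A ⊛ B ≈ shift (A ⊛ tail B)
  ⊛-head-zeroʳ A {B} B₀≡0 =
    ≈-trans (⊛-comm A B) (≈-trans (⊛-head-zeroˡ A B₀≡0) (shift-cong (⊛-comm (tail B) A)))

  ⊛-order : ∀ p q {A B} → A ≈[ p ] 0S → B ≈[ q ] 0S →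
            A ⊛ B ≈[ p + q ] 0S × (A ⊛ B) (p + q) ≡ A p ℚ.* B q
  ⊛-order zero zero _ _ = (λ _ ()) , refl
  ⊛-order (suc p) q {A} {B} hA hB with ⊛-order p q {tail A} (≈[]-tail hA) hB
  ... | below , leading = shifted-below , trans (shifted (suc (p + q))) leading
    where
    shifted : A ⊛ B ≈ shift (tail A ⊛ B)
    shifted = ⊛-head-zeroˡ B (hA 0 (s≤s z≤n))
    shifted-below : A ⊛ B ≈[ suc p + q ] 0S
    shifted-below zero _ = shifted 0
    shifted-below (suc i) (s≤s i<p+q) = trans (shifted (suc i)) (below i i<p+q)
  ⊛-order zero (suc q) {A} {B} hA hB with ⊛-order zero q {A} {tail B} hA (≈[]-tail hB)
  ... | below , leading = shifted-below , trans (shifted (suc q)) leading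
    where
    shifted : A ⊛ B ≈ shift (A ⊛ tail B)
    shifted = ⊛-head-zeroʳ A (hB 0 (s≤s z≤n))
    shifted-below : A ⊛ B ≈[ suc q ] 0S
    shifted-below zero _ = shifted 0
    shifted-below (suc i) (s≤s i<q) = trans (shifted (suc i)) (below i i<q)

  ⊛-vanishesˡ : ∀ n {A} B → A ≈[ n ] 0S → A ⊛ B ≈[ n ] 0S
  ⊛-vanishesˡ n B hA i i<n = proj₁ (⊛-order n 0 hA (λ _ ())) i (subst (i <_) (sym (ℕ.+-identityʳ n)) i<n)

  private
    ≢0⇒cancel : ∀ {x} y → y ≢ 0ℚ → x ℚ.* y ≡ 0ℚ → x ≡ 0ℚ
    ≢0⇒cancel {x} y y≢0 xy≡0 = begin
        x                     ≡⟨ solve 1 (λ x → x := x :* con 1ℚ) refl x ⟩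
        x ℚ.* 1ℚ              ≡⟨ cong (x ℚ.*_) (ℚ.*-inverseʳ y {{ℚ.≢-nonZero y≢0}}) ⟨
        x ℚ.* (y ℚ.* y⁻¹)     ≡⟨ ℚ.*-assoc x y y⁻¹ ⟨
        x ℚ.* y ℚ.* y⁻¹       ≡⟨ cong (ℚ._* y⁻¹) xy≡0 ⟩
        0ℚ ℚ.* y⁻¹            ≡⟨ ℚ.*-zeroˡ y⁻¹ ⟩
        0ℚ                    ∎
      where
      open ≡-Reasoning
      y⁻¹ = ℚ.1/_ y {{ℚ.≢-nonZero y≢0}}

  -- Compare the lowest nonzero coefficients of A and B.
  zero-product : ∀ A B → A ⊛ B ≈ 0S → ¬ A ≈ 0S → B ≈ 0S
  zero-product A B AB≈0 A≉0 k = B-vanishes (suc k) k (ℕ.n<1+n k)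
    where
    B-vanishes : ∀ n → B ≈[ n ] 0S
    B-vanishes zero = λ _ ()
    B-vanishes (suc n) with B n ℚ.≟ 0ℚ
    ... | yes Bₙ≡0 = ≈[]-extend (B-vanishes n) Bₙ≡0
    ... | no Bₙ≢0 = ⊥-elim (A≉0 λ i → A-vanishes (suc i) i (ℕ.n<1+n i))
      where
      A-vanishes : ∀ m → A ≈[ m ] 0S
      A-vanishes zero = λ _ ()
      A-vanishes (suc m) = ≈[]-extend (A-vanishes m)
        (≢0⇒cancel (B n) Bₙ≢0
          (trans (sym (proj₂ (⊛-order m n (A-vanishes m) (B-vanishes n)))) (AB≈0 (m + n))))

  ⊛-cancelˡ : ∀ {A U V} → ¬ A ≈ 0S → A ⊛ U ≈ A ⊛ V → U ≈ V
  ⊛-cancelˡ {A} {U} {V} A≉0 e = x∙y⁻¹≈ε⇒x≈y U V (zero-product A (U ⊕ ⊝ V) difference A≉0)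
    where
    open import Algebra.Properties.Ring (CommutativeRing.ring ring) using (-‿distribʳ-*)
    open import Algebra.Properties.Group (CommutativeRing.+-group ring) using (x∙y⁻¹≈ε⇒x≈y; x≈y⇒x∙y⁻¹≈ε)
    difference : A ⊛ (U ⊕ ⊝ V) ≈ 0S
    difference = ≈-trans (⊛-distribˡ A U (⊝ V))
                   (≈-trans (⊕-congˡ (A ⊛ U) (≈-sym (-‿distribʳ-* A V))) (x≈y⇒x∙y⁻¹≈ε e))

module Hensel where

  open import Data.Empty using (⊥-elim)
  open import Data.Nat using (ℕ; zero; suc; _+_; _<_; _≤_; z≤n; s≤s; _≟_)
  import Data.Nat.Properties as ℕ
  open import Data.Product using (_×_; _,_; proj₁; proj₂)
  open import Data.Rational as ℚ using (ℚ; 0ℚ; 1ℚ)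
  import Data.Rational.Properties as ℚ
  open import Data.Rational.Solver using (module +-*-Solver)
  open import Relation.Binary.PropositionalEquality
  open import Relation.Nullary using (yes; no)
  open PowerSeries
  open Truncation

  open +-*-Solver

  ⊛-increment : ∀ k {A A′ B B′} → A ≈[ suc k ] A′ → B ≈[ suc k ] B′ →
                (A ⊛ B) (suc k) ℚ.- (A′ ⊛ B′) (suc k)
                  ≡ A 0 ℚ.* (B (suc k) ℚ.- B′ (suc k)) ℚ.+ B 0 ℚ.* (A (suc k) ℚ.- A′ (suc k))
  ⊛-increment k {A} {A′} {B} {B′} A≈A′ B≈B′ = begin
      (A ⊛ B) (suc k) ℚ.- (A′ ⊛ B′) (suc k)
    ≡⟨ cong (ℚ._- (A′ ⊛ B′) (suc k)) (⊛-cong A≈A′+D B≈B′+E (suc k)) ⟩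
      ((A′ ⊕ D) ⊛ (B′ ⊕ E)) (suc k) ℚ.- (A′ ⊛ B′) (suc k)
    ≡⟨ cong (ℚ._- (A′ ⊛ B′) (suc k)) (expand (suc k)) ⟩
      (A′ ⊛ B′) (suc k) ℚ.+ ((A′ ⊛ E) (suc k) ℚ.+ (D ⊛ B′) (suc k) ℚ.+ (D ⊛ E) (suc k))
        ℚ.- (A′ ⊛ B′) (suc k)
    ≡⟨ cong (λ z → (A′ ⊛ B′) (suc k) ℚ.+ z ℚ.- (A′ ⊛ B′) (suc k))
            (cong₂ ℚ._+_ (cong₂ ℚ._+_ A′E DB′) DE) ⟩
      (A′ ⊛ B′) (suc k) ℚ.+ (A′ 0 ℚ.* E (suc k) ℚ.+ D (suc k) ℚ.* B′ 0 ℚ.+ 0ℚ)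
        ℚ.- (A′ ⊛ B′) (suc k)
    ≡⟨ cong₂ (λ a b → (A′ ⊛ B′) (suc k) ℚ.+ (a ℚ.* E (suc k) ℚ.+ D (suc k) ℚ.* b ℚ.+ 0ℚ)
                        ℚ.- (A′ ⊛ B′) (suc k))
             (sym (A≈A′ 0 (s≤s z≤n))) (sym (B≈B′ 0 (s≤s z≤n))) ⟩
      (A′ ⊛ B′) (suc k) ℚ.+ (A 0 ℚ.* E (suc k) ℚ.+ D (suc k) ℚ.* B 0 ℚ.+ 0ℚ)
        ℚ.- (A′ ⊛ B′) (suc k)
    ≡⟨ solve 5 (λ x a e d b → x :+ (a :* e :+ d :* b :+ con 0ℚ) :- x := a :* e :+ b :* d)
             refl ((A′ ⊛ B′) (suc k)) (A 0) (E (suc k)) (D (suc k)) (B 0) ⟩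
      A 0 ℚ.* E (suc k) ℚ.+ B 0 ℚ.* D (suc k) ∎
    where
    open ≡-Reasoning
    D = A ⊕ ⊝ A′
    E = B ⊕ ⊝ B′
    A≈A′+D : A ≈ A′ ⊕ D
    A≈A′+D i = solve 2 (λ a a′ → a := a′ :+ (a :- a′)) refl (A i) (A′ i)
    B≈B′+E : B ≈ B′ ⊕ E
    B≈B′+E i = solve 2 (λ b b′ → b := b′ :+ (b :- b′)) refl (B i) (B′ i)
    expand : (A′ ⊕ D) ⊛ (B′ ⊕ E) ≈ A′ ⊛ B′ ⊕ (A′ ⊛ E ⊕ D ⊛ B′ ⊕ D ⊛ E)
    expand = solveₛ 4 (λ a d b e → (a +ₛ d) *ₛ (b +ₛ e) =ₛ a *ₛ b +ₛ (a *ₛ e +ₛ d *ₛ b +ₛ d *ₛ e)) ≈-refl A′ D B′ E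
      where open SeriesSolver using () renaming (solve to solveₛ; _:=_ to _=ₛ_; _:+_ to _+ₛ_; _:*_ to _*ₛ_)
    D≈0 : D ≈[ suc k ] 0S
    D≈0 i i<k = trans (cong (ℚ._- A′ i) (A≈A′ i i<k)) (ℚ.+-inverseʳ (A′ i))
    E≈0 : E ≈[ suc k ] 0S
    E≈0 i i<k = trans (cong (ℚ._- B′ i) (B≈B′ i i<k)) (ℚ.+-inverseʳ (B′ i))
    A′E : (A′ ⊛ E) (suc k) ≡ A′ 0 ℚ.* E (suc k)
    A′E = proj₂ (⊛-order 0 (suc k) {A′} (λ _ ()) E≈0)
    DB′ : (D ⊛ B′) (suc k) ≡ D (suc k) ℚ.* B′ 0
    DB′ = subst (λ n → (D ⊛ B′) n ≡ D (suc k) ℚ.* B′ 0) (ℕ.+-identityʳ (suc k))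
                (proj₂ (⊛-order (suc k) 0 {B = B′} D≈0 (λ _ ())))
    DE : (D ⊛ E) (suc k) ≡ 0ℚ
    DE = proj₁ (⊛-order (suc k) (suc k) D≈0 E≈0) (suc k) (ℕ.m<m+n (suc k) (s≤s z≤n))

  record HasLinearPart (Φ : Series → Series) (c φ₀ : ℚ) : Set where
    field
      constant : ∀ a → a 0 ≡ 0ℚ → Φ a 0 ≡ φ₀
      increment : ∀ k {a b} → a 0 ≡ 0ℚ → a ≈[ suc k ] b →
                  Φ a ≈[ suc k ] Φ b × Φ a (suc k) ℚ.- Φ b (suc k) ≡ c ℚ.* (a (suc k) ℚ.- b (suc k))

  open HasLinearPart public

  linear-resp : ∀ {Φ c c′ φ₀ φ₀′} → c ≡ c′ → φ₀ ≡ φ₀′ → HasLinearPart Φ c φ₀ → HasLinearPart Φ c′ φ₀′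
  linear-resp refl refl L = L

  linear-ext : ∀ {Φ Ψ c φ₀} → (∀ a → Φ a ≈ Ψ a) → HasLinearPart Φ c φ₀ → HasLinearPart Ψ c φ₀
  linear-ext {Φ} {Ψ} Φ≈Ψ L = record
    { constant = λ a a₀ → trans (sym (Φ≈Ψ a 0)) (constant L a a₀)
    ; increment = λ k {a} {b} a₀ a≈b →
        let below , step = increment L k a₀ a≈b in
        (λ i i<k → trans (sym (Φ≈Ψ a i)) (trans (below i i<k) (Φ≈Ψ b i)))
        , trans (cong₂ ℚ._-_ (sym (Φ≈Ψ a (suc k))) (sym (Φ≈Ψ b (suc k)))) step }

  linear-const : ∀ C → HasLinearPart (λ _ → C) 0ℚ (C 0)
  linear-const C = record
    { constant = λ _ _ → refl
    ; increment = λ k {a} {b} _ _ →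
        (λ _ _ → refl) , trans (ℚ.+-inverseʳ (C (suc k))) (sym (ℚ.*-zeroˡ (a (suc k) ℚ.- b (suc k)))) }

  linear-id : HasLinearPart (λ a → a) 1ℚ 0ℚ
  linear-id = record
    { constant = λ _ a₀ → a₀
    ; increment = λ k _ a≈b → a≈b , sym (ℚ.*-identityˡ _) }

  linear-neg : HasLinearPart ⊝_ (ℚ.- 1ℚ) 0ℚ
  linear-neg = record
    { constant = λ _ a₀ → cong ℚ.-_ a₀
    ; increment = λ k {a} {b} _ a≈b →
        (λ i i<k → cong ℚ.-_ (a≈b i i<k))
        , solve 2 (λ x y → (:- x) :- (:- y) := con (ℚ.- 1ℚ) :* (x :- y)) refl (a (suc k)) (b (suc k)) }

  linear-⊕ : ∀ {Φ Ψ c d φ₀ ψ₀} → HasLinearPart Φ c φ₀ → HasLinearPart Ψ d ψ₀ →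
             HasLinearPart (λ a → Φ a ⊕ Ψ a) (c ℚ.+ d) (φ₀ ℚ.+ ψ₀)
  linear-⊕ {Φ} {Ψ} {c} {d} L M = record
    { constant = λ a a₀ → cong₂ ℚ._+_ (constant L a a₀) (constant M a a₀)
    ; increment = λ k {a} {b} a₀ a≈b →
        let Lbelow , Lstep = increment L k a₀ a≈b
            Mbelow , Mstep = increment M k a₀ a≈b
        in (λ i i<k → cong₂ ℚ._+_ (Lbelow i i<k) (Mbelow i i<k))
           , trans (solve 4 (λ x y u v → (x :+ y) :- (u :+ v) := (x :- u) :+ (y :- v)) refl
                            (Φ a (suc k)) (Ψ a (suc k)) (Φ b (suc k)) (Ψ b (suc k)))
                   (trans (cong₂ ℚ._+_ Lstep Mstep) (sym (ℚ.*-distribʳ-+ (a (suc k) ℚ.- b (suc k)) c d))) }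

  linear-⊛ : ∀ {Φ Ψ c d φ₀ ψ₀} → HasLinearPart Φ c φ₀ → HasLinearPart Ψ d ψ₀ →
             HasLinearPart (λ a → Φ a ⊛ Ψ a) (φ₀ ℚ.* d ℚ.+ ψ₀ ℚ.* c) (φ₀ ℚ.* ψ₀)
  linear-⊛ {Φ} {Ψ} {c} {d} {φ₀} {ψ₀} L M = record
    { constant = λ a a₀ → cong₂ ℚ._*_ (constant L a a₀) (constant M a a₀)
    ; increment = λ k {a} {b} a₀ a≈b →
        let Lbelow , Lstep = increment L k a₀ a≈b
            Mbelow , Mstep = increment M k a₀ a≈b
        in ⊛-cong-≈[] Lbelow Mbelow
           , (begin
               (Φ a ⊛ Ψ a) (suc k) ℚ.- (Φ b ⊛ Ψ b) (suc k)
             ≡⟨ ⊛-increment k Lbelow Mbelow ⟩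
               Φ a 0 ℚ.* (Ψ a (suc k) ℚ.- Ψ b (suc k)) ℚ.+ Ψ a 0 ℚ.* (Φ a (suc k) ℚ.- Φ b (suc k))
             ≡⟨ cong₂ (λ u v → u ℚ.* (Ψ a (suc k) ℚ.- Ψ b (suc k)) ℚ.+ v ℚ.* (Φ a (suc k) ℚ.- Φ b (suc k)))
                      (constant L a a₀) (constant M a a₀) ⟩
               φ₀ ℚ.* (Ψ a (suc k) ℚ.- Ψ b (suc k)) ℚ.+ ψ₀ ℚ.* (Φ a (suc k) ℚ.- Φ b (suc k))
             ≡⟨ cong₂ (λ u v → φ₀ ℚ.* u ℚ.+ ψ₀ ℚ.* v) Mstep Lstep ⟩
               φ₀ ℚ.* (d ℚ.* (a (suc k) ℚ.- b (suc k))) ℚ.+ ψ₀ ℚ.* (c ℚ.* (a (suc k) ℚ.- b (suc k)))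
             ≡⟨ solve 5 (λ p q c d x → p :* (d :* x) :+ q :* (c :* x) := (p :* d :+ q :* c) :* x)
                      refl φ₀ ψ₀ c d (a (suc k) ℚ.- b (suc k)) ⟩
               (φ₀ ℚ.* d ℚ.+ ψ₀ ℚ.* c) ℚ.* (a (suc k) ℚ.- b (suc k)) ∎) }
    where open ≡-Reasoning

  -- Hensel's lemma in ℚ[[t]]: a root of Φ is built coefficient by coefficient,
  -- each step solving the linear equation given by the linear part.
  module Root {Φ : Series → Series} {c : ℚ} (c≢0 : c ≢ 0ℚ) (L : HasLinearPart Φ c 0ℚ) where

    private
      c⁻¹ : ℚ
      c⁻¹ = ℚ.1/_ c {{ℚ.≢-nonZero c≢0}}

      c*c⁻¹ : c ℚ.* c⁻¹ ≡ 1ℚ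
      c*c⁻¹ = ℚ.*-inverseʳ c {{ℚ.≢-nonZero c≢0}}

    abstract
      private
        set : ℕ → ℚ → Series → Series
        set k v A i with i ≟ k
        ... | yes _ = v
        ... | no _ = A i

        set-same : ∀ k v A → set k v A k ≡ v
        set-same k v A with k ≟ k
        ... | yes _ = refl
        ... | no k≢k = ⊥-elim (k≢k refl)

        set-other : ∀ {k i} v A → i ≢ k → set k v A i ≡ A i
        set-other {k} {i} v A i≢k with i ≟ k
        ... | yes i≡k = ⊥-elim (i≢k i≡k)
        ... | no _ = refl

        -- approx k is the root truncated below degree k.
        approx : ℕ → Series
        approx zero = 0S
        approx (suc k) = set k (ℚ.- (Φ (approx k) k ℚ.* c⁻¹)) (approx k)

        approx-high : ∀ k i → k ≤ i → approx k i ≡ 0ℚ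
        approx-high zero i _ = refl
        approx-high (suc k) i k<i =
          trans (set-other _ (approx k) (λ i≡k → ℕ.<-irrefl (sym i≡k) k<i)) (approx-high k i (ℕ.<⇒≤ k<i))

        approx-step : ∀ k i → i < k → approx (suc k) i ≡ approx k i
        approx-step k i i<k = set-other _ (approx k) (λ i≡k → ℕ.<-irrefl i≡k i<k)

        approx-stable : ∀ k m i → i < k → approx (k + m) i ≡ approx k i
        approx-stable k zero i i<k rewrite ℕ.+-identityʳ k = refl
        approx-stable k (suc m) i i<k rewrite ℕ.+-suc k m =
          trans (approx-step (k + m) i (ℕ.<-≤-trans i<k (ℕ.m≤m+n k m))) (approx-stable k m i i<k)

        approx-0 : ∀ k → approx k 0 ≡ 0ℚ
        approx-0 zero = refl
        approx-0 (suc zero) =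
          trans (set-same 0 _ 0S) (trans (cong (λ z → ℚ.- (z ℚ.* c⁻¹)) (constant L 0S refl))
                                         (cong ℚ.-_ (ℚ.*-zeroˡ c⁻¹)))
        approx-0 (suc (suc k)) = trans (approx-step (suc k) 0 (s≤s z≤n)) (approx-0 (suc k))

        approx-vanishes : ∀ k → Φ (approx (suc k)) k ≡ 0ℚ
        approx-vanishes zero = constant L (approx 1) (approx-0 1)
        approx-vanishes (suc k) = begin
            Φ a (suc k)
          ≡⟨ solve 2 (λ x y → x := (x :- y) :+ y) refl (Φ a (suc k)) (Φ b (suc k)) ⟩
            (Φ a (suc k) ℚ.- Φ b (suc k)) ℚ.+ Φ b (suc k)
          ≡⟨ cong (ℚ._+ Φ b (suc k))
                  (proj₂ (increment L k (approx-0 (suc (suc k))) (λ i i<k → approx-step (suc k) i i<k))) ⟩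
            c ℚ.* (a (suc k) ℚ.- b (suc k)) ℚ.+ Φ b (suc k)
          ≡⟨ cong₂ (λ u v → c ℚ.* (u ℚ.- v) ℚ.+ Φ b (suc k))
                   (set-same (suc k) _ b) (approx-high (suc k) (suc k) ℕ.≤-refl) ⟩
            c ℚ.* (ℚ.- (Φ b (suc k) ℚ.* c⁻¹) ℚ.- 0ℚ) ℚ.+ Φ b (suc k)
          ≡⟨ solve 3 (λ c i x → c :* (:- (x :* i) :- con 0ℚ) :+ x := x :* (con 1ℚ :- c :* i))
                   refl c c⁻¹ (Φ b (suc k)) ⟩
            Φ b (suc k) ℚ.* (1ℚ ℚ.- c ℚ.* c⁻¹)
          ≡⟨ cong (λ z → Φ b (suc k) ℚ.* (1ℚ ℚ.- z)) c*c⁻¹ ⟩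
            Φ b (suc k) ℚ.* (1ℚ ℚ.- 1ℚ)
          ≡⟨ ℚ.*-zeroʳ (Φ b (suc k)) ⟩
            0ℚ ∎
          where
          open ≡-Reasoning
          a b : Series
          a = approx (suc (suc k))
          b = approx (suc k)

      root : Series
      root i = approx (suc i) i

      private
        root≈approx : ∀ k → root ≈[ k ] approx k
        root≈approx k i i<k with ℕ.m≤n⇒∃[o]m+o≡n i<k
        ... | m , e = trans (sym (approx-stable (suc i) m i (ℕ.n<1+n i))) (cong (λ n → approx n i) e)

      root-0 : root 0 ≡ 0ℚ
      root-0 = approx-0 1

      root-vanishes : Φ root ≈ 0S
      root-vanishes k =
        trans (proj₁ (increment L k root-0 (root≈approx (suc k))) k (ℕ.n<1+n k)) (approx-vanishes k)

      root-unique : ∀ {a} K → a 0 ≡ 0ℚ → Φ a ≈[ K ] 0S → a ≈[ K ] root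
      root-unique {a} K a₀ Φa≈0 = agrees K ℕ.≤-refl
        where
        cancel-c : ∀ {x y} → c ℚ.* (x ℚ.- y) ≡ 0ℚ → x ≡ y
        cancel-c {x} {y} e = begin
            x                                  ≡⟨ solve 2 (λ x y → x := (x :- y) :* con 1ℚ :+ y) refl x y ⟩
            (x ℚ.- y) ℚ.* 1ℚ ℚ.+ y             ≡⟨ cong (λ z → (x ℚ.- y) ℚ.* z ℚ.+ y) c*c⁻¹ ⟨
            (x ℚ.- y) ℚ.* (c ℚ.* c⁻¹) ℚ.+ y    ≡⟨ solve 4 (λ x y c i → (x :- y) :* (c :* i) :+ y := (c :* (x :- y)) :* i :+ y)
                                                        refl x y c c⁻¹ ⟩
            c ℚ.* (x ℚ.- y) ℚ.* c⁻¹ ℚ.+ y      ≡⟨ cong (λ z → z ℚ.* c⁻¹ ℚ.+ y) e ⟩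
            0ℚ ℚ.* c⁻¹ ℚ.+ y                   ≡⟨ solve 2 (λ i y → con 0ℚ :* i :+ y := y) refl c⁻¹ y ⟩
            y                                  ∎
          where open ≡-Reasoning
        next : ∀ n → a ≈[ suc n ] root → suc n < K → a (suc n) ≡ root (suc n)
        next n below n<K = cancel-c (begin
            c ℚ.* (a (suc n) ℚ.- root (suc n))        ≡⟨ proj₂ (increment L n a₀ below) ⟨
            Φ a (suc n) ℚ.- Φ root (suc n)             ≡⟨ cong₂ ℚ._-_ (Φa≈0 (suc n) n<K) (root-vanishes (suc n)) ⟩
            0ℚ ℚ.- 0ℚ                                  ≡⟨ ℚ.+-inverseʳ 0ℚ ⟩
            0ℚ                                         ∎)
          where open ≡-Reasoning
        agrees : ∀ n → n ≤ K → a ≈[ n ] root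
        agrees zero _ = λ _ ()
        agrees (suc zero) _ = ≈[]-extend (λ _ ()) (trans a₀ (sym root-0))
        agrees (suc (suc n)) n<K =
          ≈[]-extend (agrees (suc n) (ℕ.<⇒≤ n<K)) (next n (agrees (suc n) (ℕ.<⇒≤ n<K)) n<K)

    -- If Φ 0 ≈ t^n with n > 0, the root starts with -c⁻¹ t^n.
    root-order : ∀ {n} → 0 < n → Φ 0S ≈ 𝕥 ^ n → root ≈[ n ] 0S × root n ≢ 0ℚ
    root-order {suc m} _ Φ0≈𝕥^ = (λ i i<n → trans (sym (a≈root i (ℕ.m<n⇒m<1+n i<n))) (a-low i i<n))
                       , root-top≢0
      where
      open ≡-Reasoning
      n = suc m
      a : Series
      a = (ℚ.- c⁻¹) · 𝕥 ^ n
      𝕥^n-low : 𝕥 ^ n ≈[ n ] 0S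
      𝕥^n-low i i<n = trans (𝕥^-coeff n i) (cong fromℕ (δ-off (λ n≡i → ℕ.<-irrefl (sym n≡i) i<n)))
      𝕥^n-top : (𝕥 ^ n) n ≡ 1ℚ
      𝕥^n-top = trans (𝕥^-coeff n n) (trans (cong fromℕ (δ-diag n)) (ℚ.+-identityʳ 1ℚ))
      a-low : a ≈[ n ] 0S
      a-low i i<n = trans (cong (ℚ.- c⁻¹ ℚ.*_) (𝕥^n-low i i<n)) (ℚ.*-zeroʳ (ℚ.- c⁻¹))
      a-top : a n ≡ ℚ.- c⁻¹
      a-top = trans (cong (ℚ.- c⁻¹ ℚ.*_) 𝕥^n-top) (ℚ.*-identityʳ _)
      Φa≈0 : Φ a ≈[ suc n ] 0S
      Φa≈0 = ≈[]-extend (≈[]-trans below (≈[]-trans (λ i _ → Φ0≈𝕥^ i) 𝕥^n-low)) (begin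
          Φ a n                                         ≡⟨ solve 2 (λ x y → x := (x :- y) :+ y) refl (Φ a n) (Φ 0S n) ⟩
          (Φ a n ℚ.- Φ 0S n) ℚ.+ Φ 0S n                 ≡⟨ cong₂ ℚ._+_ step (Φ0≈𝕥^ n) ⟩
          c ℚ.* (a n ℚ.- 0ℚ) ℚ.+ (𝕥 ^ n) n             ≡⟨ cong₂ (λ u v → c ℚ.* (u ℚ.- 0ℚ) ℚ.+ v) a-top 𝕥^n-top ⟩
          c ℚ.* (ℚ.- c⁻¹ ℚ.- 0ℚ) ℚ.+ 1ℚ                ≡⟨ solve 2 (λ c i → c :* (:- i :- con 0ℚ) :+ con 1ℚ := con 1ℚ :- c :* i) refl c c⁻¹ ⟩
          1ℚ ℚ.- c ℚ.* c⁻¹                              ≡⟨ cong (λ z → 1ℚ ℚ.- z) c*c⁻¹ ⟩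
          1ℚ ℚ.- 1ℚ                                     ≡⟨ ℚ.+-inverseʳ 1ℚ ⟩
          0ℚ                                            ∎)
        where
        increment-from-0 = increment L m (a-low 0 (s≤s z≤n)) a-low
        below : Φ a ≈[ n ] Φ 0S
        below = proj₁ increment-from-0
        step : Φ a n ℚ.- Φ 0S n ≡ c ℚ.* (a n ℚ.- 0ℚ)
        step = proj₂ increment-from-0
      a≈root : a ≈[ suc n ] root
      a≈root = root-unique (suc n) (a-low 0 (s≤s z≤n)) Φa≈0
      root-top≢0 : root n ≢ 0ℚ
      root-top≢0 root≡0 = ℚ.1≢0 (begin
        1ℚ                      ≡⟨ c*c⁻¹ ⟨
        c ℚ.* c⁻¹               ≡⟨ cong (c ℚ.*_) (solve 1 (λ x → x := :- (:- x)) refl c⁻¹) ⟩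
        c ℚ.* ℚ.- (ℚ.- c⁻¹)     ≡⟨ cong (λ z → c ℚ.* ℚ.- z) (trans (sym a-top) (trans (a≈root n ℕ.≤-refl) root≡0)) ⟩
        c ℚ.* ℚ.- 0ℚ            ≡⟨ solve 1 (λ c → c :* (:- con 0ℚ) := con 0ℚ) refl c ⟩
        0ℚ                      ∎)

module Polynomial where

  open import Data.Bool using (if_then_else_; _∧_)
  open import Data.Empty using (⊥-elim)
  open import Data.List using ([]; _∷_; map; _++_; replicate)
  open import Data.List.Membership.Propositional using (_∈_)
  open import Data.List.Membership.Propositional.Properties using (∈-∃++)
  open import Data.List.Relation.Binary.Permutation.Propositional as ↭
    using (_↭_; ↭-refl; ↭-prep; ↭-swap; ↭-sym; ↭-trans; module PermutationReasoning)
  open import Data.List.Relation.Binary.Permutation.Propositional.Properties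
    using (shift; shifts; drop-∷; ¬x∷xs↭[]; ∈-resp-↭; map⁺; ↭-map-inv; ++⁺; ++⁺ˡ)
  open import Data.List.Properties using (map-injective; map-++)
  open import Function.Definitions using (Injective)
  open import Data.List.Relation.Unary.All as All using (All; []; _∷_)
  import Data.List.Relation.Unary.All.Properties as All
  open import Data.List.Relation.Unary.Any using (here; there)
  open import Data.Nat using (ℕ; zero; suc; _+_; _<_; _≤_; z≤n; s≤s; _≟_; _⊔_)
  import Data.Nat.Properties as ℕ
  open import Data.Product using (_×_; _,_; proj₁; proj₂)
  import Data.Product.Properties as Product
  open import Relation.Binary.Definitions using (DecidableEquality; Decidable)
  open import Relation.Binary.PropositionalEquality
  open import Relation.Nullary using (¬_; yes; no)
  open import Relation.Nullary.Decidable using (⌊_⌋)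

  monomial-coeff : ℕ × ℕ → ℕ → ℕ → ℕ
  monomial-coeff (a , b) i j = if ⌊ a ≟ i ⌋ ∧ ⌊ b ≟ j ⌋ then 1 else 0

  monomial-coeff-same : ∀ a b → monomial-coeff (a , b) a b ≡ 1
  monomial-coeff-same a b with a ≟ a | b ≟ b
  ... | yes _ | yes _ = refl
  ... | yes _ | no b≢b = ⊥-elim (b≢b refl)
  ... | no a≢a | _ = ⊥-elim (a≢a refl)

  monomial-coeff-other : ∀ {a b i j} → (a , b) ≢ (i , j) → monomial-coeff (a , b) i j ≡ 0
  monomial-coeff-other {a} {b} {i} {j} ab≢ij with a ≟ i | b ≟ j
  ... | yes refl | yes refl = ⊥-elim (ab≢ij refl)
  ... | yes _ | no _ = refl
  ... | no _ | _ = refl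

  ≟-monomial : DecidableEquality (ℕ × ℕ)
  ≟-monomial = Product.≡-dec _≟_ _≟_

  coeff-++ : ∀ p q i j → coeff (p ++ q) i j ≡ coeff p i j + coeff q i j
  coeff-++ [] q i j = refl
  coeff-++ ((a , b) ∷ p) q i j =
    trans (cong (monomial-coeff (a , b) i j +_) (coeff-++ p q i j)) (sym (ℕ.+-assoc (monomial-coeff (a , b) i j) _ _))

  -- Equal coefficients means equal monomial lists up to permutation.  Below, ↭ serves as
  -- polynomial equality: being a data type, it does not block unification as ≈P does.
  ↭⇒≈P : ∀ {p q} → p ↭ q → p ≈P q
  ↭⇒≈P ↭.refl i j = refl
  ↭⇒≈P (↭.prep m p↭q) i j = cong (monomial-coeff m i j +_) (↭⇒≈P p↭q i j)
  ↭⇒≈P (↭.swap m n p↭q) i j =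
    trans (sym (ℕ.+-assoc (monomial-coeff m i j) _ _))
          (trans (cong₂ _+_ (ℕ.+-comm (monomial-coeff m i j) _) (↭⇒≈P p↭q i j))
                 (ℕ.+-assoc (monomial-coeff n i j) _ _))
  ↭⇒≈P (↭.trans p↭q q↭r) i j = trans (↭⇒≈P p↭q i j) (↭⇒≈P q↭r i j)

  coeff-pos⇒∈ : ∀ p {i j} → 0 < coeff p i j → (i , j) ∈ p
  coeff-pos⇒∈ [] ()
  coeff-pos⇒∈ ((a , b) ∷ p) {i} {j} pos with ≟-monomial (a , b) (i , j)
  ... | yes refl = here refl
  ... | no ab≢ij = there (coeff-pos⇒∈ p (subst (0 <_) (cong (_+ coeff p i j) (monomial-coeff-other ab≢ij)) pos))

  ≈P⇒↭ : ∀ p q → p ≈P q → p ↭ q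
  ≈P⇒↭ [] [] _ = ↭-refl
  ≈P⇒↭ [] ((a , b) ∷ q) e = ⊥-elim (ℕ.0≢1+n (trans (e a b) (cong (_+ coeff q a b) (monomial-coeff-same a b))))
  ≈P⇒↭ ((a , b) ∷ p) q e
    with ys , zs , refl ← ∈-∃++ (coeff-pos⇒∈ q (subst (0 <_) (trans (cong (_+ coeff p a b) (sym (monomial-coeff-same a b))) (e a b))
                                                             (s≤s z≤n))) =
    ↭-trans (↭-prep (a , b) (≈P⇒↭ p (ys ++ zs) rest)) (↭-sym (shift (a , b) ys zs))
    where
    rest : p ≈P (ys ++ zs)
    rest i j = ℕ.+-cancelˡ-≡ (monomial-coeff (a , b) i j) _ _
                 (trans (e i j) (↭⇒≈P (shift (a , b) ys zs) i j))

  open import Data.List.Membership.DecPropositional ≟-monomial using (_∈?_)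

  infix 4 _↭?_
  _↭?_ : Decidable {A = Poly} _↭_
  [] ↭? [] = yes ↭-refl
  [] ↭? (m ∷ q) = no (λ e → ¬x∷xs↭[] (↭-sym e))
  (m ∷ p) ↭? q with m ∈? q
  ... | no m∉q = no (λ e → m∉q (∈-resp-↭ e (here refl)))
  ... | yes m∈q with ys , zs , refl ← ∈-∃++ m∈q with p ↭? (ys ++ zs)
  ...   | yes p↭ = yes (↭-trans (↭-prep m p↭) (↭-sym (shift m ys zs)))
  ...   | no ¬p↭ = no (λ e → ¬p↭ (drop-∷ (↭-trans e (shift m ys zs))))

  map-injective-↭ : ∀ {f : ℕ × ℕ → ℕ × ℕ} → Injective _≡_ _≡_ f → ∀ {p q} → map f p ↭ map f q → p ↭ q
  map-injective-↭ {f} f-inj {p} {q} e with ↭-map-inv f {p} e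
  ... | q′ , q≡ , p↭q′ rewrite map-injective f-inj q≡ = p↭q′

  _⊹_ : ℕ × ℕ → ℕ × ℕ → ℕ × ℕ
  (a , b) ⊹ (c , d) = (a + c , b + d)

  mul-congʳ : ∀ q {p p′} → p ↭ p′ → mul p q ↭ mul p′ q
  mul-congʳ q ↭.refl = ↭-refl
  mul-congʳ q (↭.prep m p↭p′) = ++⁺ˡ (map (m ⊹_) q) (mul-congʳ q p↭p′)
  mul-congʳ q (↭.swap m n p↭p′) =
    ↭-trans (shifts (map (m ⊹_) q) (map (n ⊹_) q)) (++⁺ˡ (map (n ⊹_) q) (++⁺ˡ (map (m ⊹_) q) (mul-congʳ q p↭p′)))
  mul-congʳ q (↭.trans p↭p′ p′↭p″) = ↭-trans (mul-congʳ q p↭p′) (mul-congʳ q p′↭p″)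

  mul-congˡ : ∀ p {q q′} → q ↭ q′ → mul p q ↭ mul p q′
  mul-congˡ [] q↭q′ = ↭-refl
  mul-congˡ (m ∷ p) q↭q′ = ++⁺ (map⁺ (m ⊹_) q↭q′) (mul-congˡ p q↭q′)

  mul-cong : ∀ {p p′ q q′} → p ↭ p′ → q ↭ q′ → mul p q ↭ mul p′ q′
  mul-cong {p′ = p′} {q = q} p↭p′ q↭q′ = ↭-trans (mul-congʳ q p↭p′) (mul-congˡ p′ q↭q′)

  Bounded : (ℕ × ℕ → ℕ) → ℕ → Poly → Set
  Bounded deg M = All (λ m → deg m < M)

  XBounded YBounded : ℕ → Poly → Set
  XBounded = Bounded proj₁
  YBounded = Bounded proj₂

  bound : (ℕ × ℕ → ℕ) → Poly → ℕ
  bound deg [] = 0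
  bound deg (m ∷ p) = suc (deg m) ⊔ bound deg p

  Bounded-weaken : ∀ {deg M N p} → M ≤ N → Bounded deg M p → Bounded deg N p
  Bounded-weaken M≤N = All.map (λ d<M → ℕ.<-≤-trans d<M M≤N)

  bound-correct : ∀ deg p → Bounded deg (bound deg p) p
  bound-correct deg [] = []
  bound-correct deg (m ∷ p) =
    ℕ.m≤m⊔n (suc (deg m)) (bound deg p) ∷ Bounded-weaken (ℕ.m≤n⊔m (suc (deg m)) _) (bound-correct deg p)

  common-bound : ∀ deg p q → Bounded deg (bound deg p ⊔ bound deg q) p × Bounded deg (bound deg p ⊔ bound deg q) q
  common-bound deg p q = Bounded-weaken (ℕ.m≤m⊔n _ _) (bound-correct deg p)
                       , Bounded-weaken (ℕ.m≤n⊔m _ _) (bound-correct deg q)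

  Bounded-mul : ∀ deg → (∀ m n → deg (m ⊹ n) ≡ deg m + deg n) →
                ∀ {M N p q} → Bounded deg M p → Bounded deg (suc N) q → Bounded deg (M + N) (mul p q)
  Bounded-mul deg deg-⊹ {p = []} [] _ = []
  Bounded-mul deg deg-⊹ {p = m ∷ p} {q} (dm<M ∷ p<M) q≤N =
    All.++⁺ (All.map⁺ (All.map (λ {n} dn≤N → subst (_< _) (sym (deg-⊹ m n)) (ℕ.+-mono-<-≤ dm<M (ℕ.≤-pred dn≤N))) q≤N))
            (Bounded-mul deg deg-⊹ p<M q≤N)

  coeff-beyond : ∀ deg {M} p {i j} → Bounded deg M p → M ≤ deg (i , j) → coeff p i j ≡ 0
  coeff-beyond deg [] _ _ = refl
  coeff-beyond deg ((a , b) ∷ p) (d<M ∷ p<M) M≤d =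
    cong₂ _+_ (monomial-coeff-other {a} {b} (λ { refl → ℕ.<⇒≱ d<M M≤d })) (coeff-beyond deg p p<M M≤d)

  record Leading (deg : ℕ × ℕ → ℕ) (m : ℕ × ℕ) (p : Poly) : Set where
    constructor leading
    field
      lower : Poly
      split : p ↭ m ∷ lower
      lower< : Bounded deg (deg m) lower

  Leading-nonzero : ∀ {deg m p} → Leading deg m p → ¬ (p ↭ [])
  Leading-nonzero (leading _ split _) p↭[] = ¬x∷xs↭[] (↭-trans (↭-sym split) p↭[])

  Leading-mul : ∀ deg → (∀ m n → deg (m ⊹ n) ≡ deg m + deg n) →
                ∀ {m n p q} → Leading deg m p → Leading deg n q → Leading deg (m ⊹ n) (mul p q)
  Leading-mul deg deg-⊹ {m} {n} (leading lo₁ split₁ lo₁<) (leading lo₂ split₂ lo₂<) = leading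
    (map (m ⊹_) lo₂ ++ mul lo₁ (n ∷ lo₂))
    (mul-cong split₁ split₂)
    (subst (λ d → Bounded deg d _) (sym (deg-⊹ m n))
      (All.++⁺ (All.map⁺ (All.map (λ {k} dk<dn → subst (_< deg m + deg n) (sym (deg-⊹ m k)) (ℕ.+-monoʳ-< (deg m) dk<dn)) lo₂<))
               (Bounded-mul deg deg-⊹ lo₁< (ℕ.≤-refl ∷ Bounded-weaken (ℕ.n≤1+n _) lo₂<))))

  raiseX raiseY : ℕ × ℕ → ℕ × ℕ
  raiseX (a , b) = (suc a , b)
  raiseY (a , b) = (a , suc b)

  y⁰-part y-quotient : Poly → Poly
  y⁰-part [] = []
  y⁰-part ((a , zero) ∷ p) = (a , zero) ∷ y⁰-part p
  y⁰-part ((a , suc b) ∷ p) = y⁰-part p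
  y-quotient [] = []
  y-quotient ((a , zero) ∷ p) = y-quotient p
  y-quotient ((a , suc b) ∷ p) = (a , b) ∷ y-quotient p

  y-split : ∀ p → p ↭ y⁰-part p ++ map raiseY (y-quotient p)
  y-split [] = ↭-refl
  y-split ((a , zero) ∷ p) = ↭-prep (a , zero) (y-split p)
  y-split ((a , suc b) ∷ p) =
    ↭-trans (↭-prep (a , suc b) (y-split p)) (↭-sym (shift (a , suc b) (y⁰-part p) _))

  y⁰-part-y-free : ∀ p → YBounded 1 (y⁰-part p)
  y⁰-part-y-free [] = []
  y⁰-part-y-free ((a , zero) ∷ p) = s≤s z≤n ∷ y⁰-part-y-free p
  y⁰-part-y-free ((a , suc b) ∷ p) = y⁰-part-y-free p

  y⁰-part-XBounded : ∀ {n} p → XBounded n p → XBounded n (y⁰-part p)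
  y⁰-part-XBounded [] [] = []
  y⁰-part-XBounded ((a , zero) ∷ p) (a<n ∷ p<n) = a<n ∷ y⁰-part-XBounded p p<n
  y⁰-part-XBounded ((a , suc b) ∷ p) (a<n ∷ p<n) = y⁰-part-XBounded p p<n

  y-quotient-XBounded : ∀ {n} p → XBounded n p → XBounded n (y-quotient p)
  y-quotient-XBounded [] [] = []
  y-quotient-XBounded ((a , zero) ∷ p) (a<n ∷ p<n) = y-quotient-XBounded p p<n
  y-quotient-XBounded ((a , suc b) ∷ p) (a<n ∷ p<n) = a<n ∷ y-quotient-XBounded p p<n

  y-quotient-YBounded : ∀ {K} p → YBounded (suc K) p → YBounded K (y-quotient p)
  y-quotient-YBounded [] [] = []
  y-quotient-YBounded ((a , zero) ∷ p) (_ ∷ p<K) = y-quotient-YBounded p p<K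
  y-quotient-YBounded ((a , suc b) ∷ p) (s≤s b<K ∷ p<K) = b<K ∷ y-quotient-YBounded p p<K

  ++-cancelʳ-↭ : ∀ {p q} r → p ++ r ↭ q ++ r → p ↭ q
  ++-cancelʳ-↭ {p} {q} r e = ≈P⇒↭ p q λ i j → ℕ.+-cancelʳ-≡ (coeff r i j) _ _
    (trans (sym (coeff-++ p r i j)) (trans (↭⇒≈P e i j) (coeff-++ q r i j)))

  -- p(1, y), and the quotient (p(1, y) - p(x, y)) / (1 - x)
  at-x=1 : Poly → Poly
  at-x=1 = map λ (a , b) → (0 , b)

  x-below : ℕ × ℕ → Poly
  x-below (zero , b) = []
  x-below (suc a , b) = (a , b) ∷ x-below (a , b)

  x-diff : Poly → Poly
  x-diff [] = []
  x-diff (m ∷ p) = x-below m ++ x-diff p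

  -- 1 + x (1 + ⋯ + x^(a-1)) = x^a + (1 + ⋯ + x^(a-1))
  telescope : ∀ p → at-x=1 p ++ map raiseX (x-diff p) ↭ p ++ x-diff p
  telescope [] = ↭-refl
  telescope ((a , b) ∷ p) = begin
      (0 , b) ∷ (at-x=1 p ++ map raiseX (x-below (a , b) ++ x-diff p))
    ≡⟨ cong (λ l → (0 , b) ∷ (at-x=1 p ++ l)) (map-++ raiseX (x-below (a , b)) (x-diff p)) ⟩
      (0 , b) ∷ (at-x=1 p ++ (map raiseX (x-below (a , b)) ++ map raiseX (x-diff p)))
    ↭⟨ ↭-prep (0 , b) (shifts (at-x=1 p) (map raiseX (x-below (a , b)))) ⟩
      ((0 , b) ∷ map raiseX (x-below (a , b))) ++ (at-x=1 p ++ map raiseX (x-diff p))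
    ↭⟨ ++⁺ (column a) (telescope p) ⟩
      ((a , b) ∷ x-below (a , b)) ++ (p ++ x-diff p)
    ↭⟨ ↭-prep (a , b) (shifts (x-below (a , b)) p) ⟩
      (a , b) ∷ (p ++ (x-below (a , b) ++ x-diff p))
    ∎
    where
    open PermutationReasoning
    column : ∀ a → (0 , b) ∷ map raiseX (x-below (a , b)) ↭ (a , b) ∷ x-below (a , b)
    column zero = ↭-refl
    column (suc a) = ↭-trans (↭-swap (0 , b) (suc a , b) ↭-refl) (↭-prep (suc a , b) (column a))

  at-x=1-x-free : ∀ p → XBounded 1 (at-x=1 p)
  at-x=1-x-free [] = []
  at-x=1-x-free (m ∷ p) = s≤s z≤n ∷ at-x=1-x-free p

  at-x=1-YBounded : ∀ {ℓ} p → YBounded ℓ p → YBounded ℓ (at-x=1 p)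
  at-x=1-YBounded p = All.map⁺ ∘ All.map id
    where open import Function.Base using (_∘_; id)

  x-diff-XBounded : ∀ {K} p → XBounded (suc K) p → XBounded K (x-diff p)
  x-diff-XBounded [] [] = []
  x-diff-XBounded ((a , b) ∷ p) (a<K ∷ p<K) = All.++⁺ (column a (ℕ.≤-pred a<K)) (x-diff-XBounded p p<K)
    where
    column : ∀ {K} a → a ≤ K → XBounded K (x-below (a , b))
    column zero _ = []
    column (suc a) a<K = a<K ∷ column a (ℕ.<⇒≤ a<K)

  x-diff-YBounded : ∀ {ℓ} p → YBounded ℓ p → YBounded ℓ (x-diff p)
  x-diff-YBounded [] [] = []
  x-diff-YBounded ((a , b) ∷ p) (b<ℓ ∷ p<ℓ) = All.++⁺ (column a) (x-diff-YBounded p p<ℓ)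
    where
    column : ∀ a → YBounded _ (x-below (a , b))
    column zero = []
    column (suc a) = b<ℓ ∷ column a

  y-count : ℕ → Poly → ℕ
  y-count L [] = 0
  y-count L ((a , b) ∷ p) with b ≟ L
  ... | yes _ = suc (y-count L p)
  ... | no _ = y-count L p

  y-below : ℕ → Poly → Poly
  y-below L [] = []
  y-below L ((a , b) ∷ p) with b ≟ L
  ... | yes _ = y-below L p
  ... | no _ = (a , b) ∷ y-below L p

  y-top-split : ∀ L p → XBounded 1 p → p ↭ replicate (y-count L p) (0 , L) ++ y-below L p
  y-top-split L [] [] = ↭-refl
  y-top-split L ((.0 , b) ∷ p) (s≤s z≤n ∷ p-free) with b ≟ L
  ... | yes refl = ↭-prep (0 , L) (y-top-split L p p-free)
  ... | no _ = ↭-trans (↭-prep (0 , b) (y-top-split L p p-free)) (↭-sym (shift (0 , b) (replicate (y-count L p) (0 , L)) _))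

  y-below-XBounded : ∀ {n} L p → XBounded n p → XBounded n (y-below L p)
  y-below-XBounded L [] [] = []
  y-below-XBounded L ((a , b) ∷ p) (a<n ∷ p<n) with b ≟ L
  ... | yes _ = y-below-XBounded L p p<n
  ... | no _ = a<n ∷ y-below-XBounded L p p<n

  y-below-YBounded : ∀ L p → YBounded (suc L) p → YBounded L (y-below L p)
  y-below-YBounded L [] [] = []
  y-below-YBounded L ((a , b) ∷ p) (b≤L ∷ p≤L) with b ≟ L
  ... | yes _ = y-below-YBounded L p p≤L
  ... | no b≢L = ℕ.≤∧≢⇒< (ℕ.≤-pred b≤L) b≢L ∷ y-below-YBounded L p p≤L

module Evaluation where

  open import Algebra.Bundles using (CommutativeRing)
  open import Data.Empty using (⊥-elim)
  open import Data.List using ([]; _∷_; map; _++_)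
  open import Data.List.Relation.Unary.All using ([]; _∷_)
  open import Data.List.Relation.Binary.Permutation.Propositional as ↭ using (_↭_)
  open import Data.Nat using (ℕ; zero; suc; _+_; _*_; _<_; z≤n; s≤s; _≟_; _<?_; _%_)
  import Data.Nat.Properties as ℕ
  open import Data.Nat.DivMod using ([m+kn]%n≡m%n; m<n⇒m%n≡m)
  open import Data.Product using (_×_; _,_; proj₁; proj₂)
  open import Data.Rational as ℚ using (ℚ)
  import Data.Rational.Properties as ℚ
  open import Relation.Binary.PropositionalEquality
  open import Relation.Nullary using (¬_; yes; no)
  open PowerSeries
  open Polynomial
  open Truncation using (_≈[_]_; ⊛-cong-≈[]; ⊛-cancelˡ)

  monomial : Series → Series → ℕ × ℕ → Series
  monomial X Y (a , b) = X ^ a ⊛ Y ^ b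

  ev : Series → Series → Poly → Series
  ev X Y [] = 0S
  ev X Y (m ∷ p) = monomial X Y m ⊕ ev X Y p

  module _ {X Y : Series} where

    open import Relation.Binary.Reasoning.Setoid (CommutativeRing.setoid ring)
    open SeriesSolver using (solve; _:=_; _:+_; _:*_)

    ev-++ : ∀ p q → ev X Y (p ++ q) ≈ ev X Y p ⊕ ev X Y q
    ev-++ [] q i = sym (ℚ.+-identityˡ _)
    ev-++ (m ∷ p) q = begin
      monomial X Y m ⊕ ev X Y (p ++ q)         ≈⟨ ⊕-congˡ (monomial X Y m) (ev-++ p q) ⟩
      monomial X Y m ⊕ (ev X Y p ⊕ ev X Y q)   ≈⟨ solve 3 (λ a b c → a :+ (b :+ c) := (a :+ b) :+ c) ≈-refl
                                                    (monomial X Y m) (ev X Y p) (ev X Y q) ⟩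
      monomial X Y m ⊕ ev X Y p ⊕ ev X Y q     ∎

    ev-↭ : ∀ {p q} → p ↭ q → ev X Y p ≈ ev X Y q
    ev-↭ ↭.refl = ≈-refl
    ev-↭ (↭.prep m p↭q) = ⊕-congˡ (monomial X Y m) (ev-↭ p↭q)
    ev-↭ (↭.swap {xs} {ys} m n p↭q) = begin
      monomial X Y m ⊕ (monomial X Y n ⊕ ev X Y xs)  ≈⟨ ⊕-congˡ (monomial X Y m) (⊕-congˡ (monomial X Y n) (ev-↭ p↭q)) ⟩
      monomial X Y m ⊕ (monomial X Y n ⊕ ev X Y ys)  ≈⟨ solve 3 (λ a b c → a :+ (b :+ c) := b :+ (a :+ c)) ≈-refl
                                                               (monomial X Y m) (monomial X Y n) (ev X Y ys) ⟩
      monomial X Y n ⊕ (monomial X Y m ⊕ ev X Y ys)  ∎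
    ev-↭ (↭.trans p↭q q↭r) = ≈-trans (ev-↭ p↭q) (ev-↭ q↭r)

    ev-map : ∀ f S → (∀ m → monomial X Y (f m) ≈ S ⊛ monomial X Y m) → ∀ p → ev X Y (map f p) ≈ S ⊛ ev X Y p
    ev-map f S f-mult [] = ≈-sym (⊛-zeroʳ S)
    ev-map f S f-mult (m ∷ p) = ≈-trans (⊕-cong (f-mult m) (ev-map f S f-mult p)) (≈-sym (⊛-distribˡ S _ _))

    monomial-⊹ : ∀ m n → monomial X Y (m ⊹ n) ≈ monomial X Y m ⊛ monomial X Y n
    monomial-⊹ (a , b) (c , d) = begin
      X ^ (a + c) ⊛ Y ^ (b + d)            ≈⟨ ⊛-cong (^-homo-* X a c) (^-homo-* Y b d) ⟩
      X ^ a ⊛ X ^ c ⊛ (Y ^ b ⊛ Y ^ d)      ≈⟨ solve 4 (λ p q r s → (p :* q) :* (r :* s) := (p :* r) :* (q :* s)) ≈-refl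
                                                  (X ^ a) (X ^ c) (Y ^ b) (Y ^ d) ⟩
      X ^ a ⊛ Y ^ b ⊛ (X ^ c ⊛ Y ^ d)      ∎

    ev-mul : ∀ p q → ev X Y (mul p q) ≈ ev X Y p ⊛ ev X Y q
    ev-mul [] q = ≈-sym (⊛-zeroˡ (ev X Y q))
    ev-mul (m ∷ p) q = begin
      ev X Y (map (m ⊹_) q ++ mul p q)                            ≈⟨ ev-++ (map (m ⊹_) q) (mul p q) ⟩
      ev X Y (map (m ⊹_) q) ⊕ ev X Y (mul p q)                    ≈⟨ ⊕-cong (ev-map (m ⊹_) _ (monomial-⊹ m) q) (ev-mul p q) ⟩
      monomial X Y m ⊛ ev X Y q ⊕ ev X Y p ⊛ ev X Y q             ≈⟨ ⊛-distribʳ (monomial X Y m) (ev X Y p) (ev X Y q) ⟨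
      (monomial X Y m ⊕ ev X Y p) ⊛ ev X Y q                      ∎

    ev-one : ev X Y one ≈ 1S
    ev-one i = trans (ℚ.+-identityʳ _) (⊛-identityˡ 1S i)

  ev-cong : ∀ {X X′ Y Y′} → X ≈ X′ → Y ≈ Y′ → ∀ p → ev X Y p ≈ ev X′ Y′ p
  ev-cong eX eY [] = ≈-refl
  ev-cong eX eY ((a , b) ∷ p) = ⊕-cong (⊛-cong (^-congˡ a eX) (^-congˡ b eY)) (ev-cong eX eY p)

  -- Kronecker substitution x ↦ t, y ↦ t^M sends x^a y^b to t^(a + M b).
  kronecker : ℕ → Poly → Series
  kronecker M = ev 𝕥 (𝕥 ^ M)

  hits : ℕ → ℕ → Poly → ℕ
  hits M k [] = 0
  hits M k ((a , b) ∷ p) = δ (a + M * b) k + hits M k p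

  kronecker-hits : ∀ M p k → kronecker M p k ≡ fromℕ (hits M k p)
  kronecker-hits M [] k = refl
  kronecker-hits M ((a , b) ∷ p) k =
    trans (cong₂ ℚ._+_ (trans (monomial≈𝕥^ k) (𝕥^-coeff (a + M * b) k)) (kronecker-hits M p k))
          (sym (fromℕ-+ (δ (a + M * b) k) (hits M k p)))
    where
    monomial≈𝕥^ : monomial 𝕥 (𝕥 ^ M) (a , b) ≈ 𝕥 ^ (a + M * b)
    monomial≈𝕥^ = ≈-trans (⊛-congˡ (𝕥 ^ a) (^-assocʳ 𝕥 M b)) (≈-sym (^-homo-* 𝕥 a (M * b)))

  private
    digits-unique : ∀ {M a b i j} → a < M → i < M → a + M * b ≡ i + M * j → a ≡ i × b ≡ j
    digits-unique {suc m} {a} {b} {i} {j} a<M i<M e = a≡i , ℕ.*-cancelˡ-≡ b j (suc m) (ℕ.+-cancelˡ-≡ a _ _ (trans e (cong (_+ _) (sym a≡i))))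
      where
      M = suc m
      digit : ∀ {c d} → c < M → (c + M * d) % M ≡ c
      digit {c} {d} c<M = trans (cong (λ z → (c + z) % M) (ℕ.*-comm M d)) (trans ([m+kn]%n≡m%n c d M) (m<n⇒m%n≡m c<M))
      a≡i : a ≡ i
      a≡i = trans (sym (digit a<M)) (trans (cong (_% M) e) (digit i<M))

    hits-coeff : ∀ M p {i j} → XBounded M p → i < M → hits M (i + M * j) p ≡ coeff p i j
    hits-coeff M [] _ _ = refl
    hits-coeff M ((a , b) ∷ p) {i} {j} (a<M ∷ p<M) i<M = cong₂ _+_ head (hits-coeff M p p<M i<M)
      where
      head : δ (a + M * b) (i + M * j) ≡ monomial-coeff (a , b) i j
      head with ≟-monomial (a , b) (i , j)
      ... | yes refl = trans (δ-diag (a + M * b)) (sym (monomial-coeff-same a b))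
      ... | no ab≢ij = trans (δ-off (λ e → ab≢ij (let a≡i , b≡j = digits-unique a<M i<M e in cong₂ _,_ a≡i b≡j)))
                             (sym (monomial-coeff-other ab≢ij))

  kronecker-coeff : ∀ M p {i j} → XBounded M p → i < M → kronecker M p (i + M * j) ≡ fromℕ (coeff p i j)
  kronecker-coeff M p p<M i<M = trans (kronecker-hits M p _) (cong fromℕ (hits-coeff M p p<M i<M))

  kronecker-injective : ∀ p q → (∀ M → kronecker M p ≈ kronecker M q) → p ≈P q
  kronecker-injective p q e = bounded (common-bound proj₁ p q)
    where
    bounded : ∀ {M} → XBounded M p × XBounded M q → p ≈P q
    bounded {M} (p<M , q<M) i j with i <? M
    ... | yes i<M = fromℕ-injective (trans (sym (kronecker-coeff M p p<M i<M))
                                           (trans (e M (i + M * j)) (kronecker-coeff M q q<M i<M)))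
    ... | no i≮M = trans (coeff-beyond proj₁ p p<M (ℕ.≮⇒≥ i≮M)) (sym (coeff-beyond proj₁ q q<M (ℕ.≮⇒≥ i≮M)))

  ↭-by-ev : ∀ p q → (∀ X Y → ev X Y p ≈ ev X Y q) → p ↭ q
  ↭-by-ev p q e = ≈P⇒↭ p q (kronecker-injective p q (λ M → e 𝕥 (𝕥 ^ M)))

  kronecker-nonzero : ∀ M m p → ¬ kronecker M (m ∷ p) ≈ 0S
  kronecker-nonzero M (a , b) p e =
    fromℕ-suc≢0 (hits M k p) (trans (cong (λ n → fromℕ (n + hits M k p)) (sym (δ-diag k)))
                                    (trans (sym (kronecker-hits M ((a , b) ∷ p) k)) (e k)))
    where k = a + M * b

  mul-cancelˡ : ∀ {p q r} → ¬ (p ↭ []) → mul p q ↭ mul p r → q ↭ r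
  mul-cancelˡ {[]} p≭[] _ = ⊥-elim (p≭[] ↭.↭-refl)
  mul-cancelˡ {m ∷ p} {q} {r} _ e = ≈P⇒↭ q r (kronecker-injective q r λ M →
    ⊛-cancelˡ (kronecker-nonzero M m p)
      (≈-trans (≈-sym (ev-mul (m ∷ p) q)) (≈-trans (ev-↭ e) (ev-mul (m ∷ p) r))))

  mul-swap : ∀ p q r → mul p (mul q r) ↭ mul q (mul p r)
  mul-swap p q r = ↭-by-ev (mul p (mul q r)) (mul q (mul p r)) λ X Y → begin
      ev X Y (mul p (mul q r))                   ≈⟨ ≈-trans (ev-mul p (mul q r)) (⊛-congˡ (ev X Y p) (ev-mul q r)) ⟩
      ev X Y p ⊛ (ev X Y q ⊛ ev X Y r)           ≈⟨ solve 3 (λ a b c → a :* (b :* c) := b :* (a :* c)) ≈-refl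
                                                          (ev X Y p) (ev X Y q) (ev X Y r) ⟩
      ev X Y q ⊛ (ev X Y p ⊛ ev X Y r)           ≈⟨ ≈-trans (ev-mul q (mul p r)) (⊛-congˡ (ev X Y q) (ev-mul p r)) ⟨
      ev X Y (mul q (mul p r))                   ∎
    where
    open import Relation.Binary.Reasoning.Setoid (CommutativeRing.setoid ring)
    open SeriesSolver using (solve; _:=_; _:*_)

  ev-cong-≈[] : ∀ {N X X′ Y Y′} → X ≈[ N ] X′ → Y ≈[ N ] Y′ → ∀ p → ev X Y p ≈[ N ] ev X′ Y′ p
  ev-cong-≈[] eX eY [] i _ = refl
  ev-cong-≈[] eX eY ((a , b) ∷ p) i i<N =
    cong₂ ℚ._+_ (⊛-cong-≈[] (^-cong-≈[] a eX) (^-cong-≈[] b eY) i i<N) (ev-cong-≈[] eX eY p i i<N)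
    where
    ^-cong-≈[] : ∀ {N A B} n → A ≈[ N ] B → A ^ n ≈[ N ] B ^ n
    ^-cong-≈[] zero e i _ = refl
    ^-cong-≈[] (suc n) e = ⊛-cong-≈[] e (^-cong-≈[] n e)

  ev-raiseX : ∀ {X Y} p → ev X Y (map raiseX p) ≈ X ⊛ ev X Y p
  ev-raiseX {X} {Y} = ev-map raiseX X (λ (a , b) → ⊛-assoc X (X ^ a) (Y ^ b))

  ev-split : ∀ {X Y} p → ev X Y p ≈ ev X Y (y⁰-part p) ⊕ Y ⊛ ev X Y (y-quotient p)
  ev-split {X} {Y} p = begin
      ev X Y p                                                   ≈⟨ ev-↭ (y-split p) ⟩
      ev X Y (y⁰-part p ++ map raiseY (y-quotient p))            ≈⟨ ev-++ (y⁰-part p) _ ⟩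
      ev X Y (y⁰-part p) ⊕ ev X Y (map raiseY (y-quotient p))    ≈⟨ ⊕-congˡ (ev X Y (y⁰-part p)) (ev-map raiseY Y raise (y-quotient p)) ⟩
      ev X Y (y⁰-part p) ⊕ Y ⊛ ev X Y (y-quotient p)             ∎
    where
    open import Relation.Binary.Reasoning.Setoid (CommutativeRing.setoid ring)
    open SeriesSolver using (solve; _:=_; _:*_)
    raise : ∀ m → monomial X Y (raiseY m) ≈ Y ⊛ monomial X Y m
    raise (a , b) = solve 3 (λ p y q → p :* (y :* q) := y :* (p :* q)) ≈-refl (X ^ a) Y (Y ^ b)

  ev-y-free : ∀ {Y} p → YBounded 1 p → ∀ i → ev 𝕥 Y p i ≡ fromℕ (coeff p i 0)
  ev-y-free [] [] i = refl
  ev-y-free {Y} ((a , zero) ∷ p) (_ ∷ p-free) i =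
    trans (cong₂ ℚ._+_ (trans (⊛-identityʳ (𝕥 ^ a) i) (trans (𝕥^-coeff a i) (cong fromℕ δ≡coeff))) (ev-y-free p p-free i))
          (sym (fromℕ-+ (monomial-coeff (a , 0) i 0) (coeff p i 0)))
    where
    δ≡coeff : δ a i ≡ monomial-coeff (a , 0) i 0
    δ≡coeff with a ≟ i
    ... | yes _ = refl
    ... | no _ = refl
  ev-y-free ((a , suc b) ∷ p) (s≤s () ∷ _) i

  y-free-injective : ∀ {n Y Y′ p q} → YBounded 1 p → YBounded 1 q → XBounded n p → XBounded n q →
                     ev 𝕥 Y p ≈[ n ] ev 𝕥 Y′ q → p ↭ q
  y-free-injective {n} {p = p} {q} p-free q-free p<n q<n e = ≈P⇒↭ p q coeffs
    where
    coeffs : p ≈P q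
    coeffs i (suc j) = trans (coeff-beyond proj₂ p p-free (s≤s z≤n)) (sym (coeff-beyond proj₂ q q-free (s≤s z≤n)))
    coeffs i zero with i <? n
    ... | yes i<n = fromℕ-injective (trans (sym (ev-y-free p p-free i)) (trans (e i i<n) (ev-y-free q q-free i)))
    ... | no i≮n = trans (coeff-beyond proj₁ p p<n (ℕ.≮⇒≥ i≮n)) (sym (coeff-beyond proj₁ q q<n (ℕ.≮⇒≥ i≮n)))

  ev-y-free-indep : ∀ {X Y Y′} p → YBounded 1 p → ev X Y p ≈ ev X Y′ p
  ev-y-free-indep [] [] = ≈-refl
  ev-y-free-indep {X} ((a , zero) ∷ p) (_ ∷ p-free) = ⊕-congˡ (X ^ a ⊛ 1S) (ev-y-free-indep p p-free)
  ev-y-free-indep ((a , suc b) ∷ p) (s≤s () ∷ _)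

  ev-at-y=0 : ∀ {X Y} p → ev X Y (y⁰-part p) ≈ ev X 0S p
  ev-at-y=0 {X} {Y} p =
    ≈-trans (ev-y-free-indep {Y′ = 0S} (y⁰-part p) (y⁰-part-y-free p))
            (≈-sym (≈-trans (ev-split p) (≈-trans (⊕-congˡ (ev X 0S (y⁰-part p)) (⊛-zeroˡ (ev X 0S (y-quotient p))))
                                                  (λ i → ℚ.+-identityʳ _))))

  ev-x^ : ∀ {X Y} n p → ev X Y (mul ((n , 0) ∷ []) p) ≈ X ^ n ⊛ ev X Y p
  ev-x^ {X} {Y} n p = ≈-trans (ev-mul ((n , 0) ∷ []) p)
                             (⊛-congʳ (ev X Y p) (≈-trans (λ i → ℚ.+-identityʳ _) (⊛-identityʳ (X ^ n))))

module Forests where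

  open import Algebra.Bundles using (CommutativeRing)
  open import Data.Empty using (⊥-elim)
  import Data.Nat.Properties as ℕ
  open import Data.List using (List; []; _∷_; _++_; length)
  open import Data.List.Membership.Propositional using (_∈_; find)
  open import Data.List.Membership.Propositional.Properties using (∈-∃++)
  open import Data.List.Relation.Binary.Permutation.Homogeneous as ≅ using ()
  open import Data.List.Relation.Binary.Permutation.Propositional as ↭
    using (_↭_; ↭-refl; ↭-sym; ↭-trans; module PermutationReasoning)
  open import Data.List.Relation.Binary.Permutation.Propositional.Properties using () renaming (shift to ↭-shift)
  open import Data.List.Relation.Binary.Pointwise.Base using (Pointwise; []; _∷_)
  open import Data.List.Relation.Unary.All as All using (All; []; _∷_)
  open import Data.List.Relation.Unary.All.Properties using (¬Any⇒All¬)
  open import Data.List.Relation.Unary.Any using (any?; here; there)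
  open import Data.List.Extrema ℕ.≤-totalOrder using (argmax; argmax-sel; f[⊥]≤f[argmax]; f[xs]≤f[argmax])
  open import Data.Nat using (ℕ; zero; suc; _+_; _≤_)
  open import Data.Product using (_×_; _,_; proj₁; proj₂; Σ-syntax)
  import Data.Rational.Properties as ℚ
  open import Data.Sum using (inj₁; inj₂)
  open import Relation.Binary.PropositionalEquality
  open import Relation.Nullary using (¬_; yes; no)
  open PowerSeries
  open Truncation using (zero-product)
  open Polynomial
  open Evaluation

  mutual
    size : Tree → ℕ
    size (node cs) = suc (sizeF cs)

    sizeF : Forest → ℕ
    sizeF [] = 0
    sizeF (t ∷ ts) = size t + sizeF ts

  sizeF-↭ : ∀ {F G} → F ↭ G → sizeF F ≡ sizeF G
  sizeF-↭ ↭.refl = refl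
  sizeF-↭ (↭.prep t F↭G) = cong (size t +_) (sizeF-↭ F↭G)
  sizeF-↭ (↭.swap {F} {G} t u F↭G) =
    trans (sym (ℕ.+-assoc (size t) (size u) (sizeF F)))
          (trans (cong₂ _+_ (ℕ.+-comm (size t) (size u)) (sizeF-↭ F↭G)) (ℕ.+-assoc (size u) (size t) (sizeF G)))
  sizeF-↭ (↭.trans F↭G G↭H) = trans (sizeF-↭ F↭G) (sizeF-↭ G↭H)

  mutual
    ≅T-refl : ∀ {T} → T ≅T T
    ≅T-refl {node cs} = node ≅F-refl

    ≅F-refl : ∀ {F} → F ≅F F
    ≅F-refl {[]} = ≅.refl []
    ≅F-refl {t ∷ ts} = ≅.prep ≅T-refl ≅F-refl

  mutual
    ≅T-sym : ∀ {T T′} → T ≅T T′ → T′ ≅T T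
    ≅T-sym (node p) = node (≅F-sym p)

    ≅F-sym : ∀ {F F′} → F ≅F F′ → F′ ≅F F
    ≅F-sym (≅.refl ps) = ≅.refl (pointwise-sym ps)
    ≅F-sym (≅.prep e p) = ≅.prep (≅T-sym e) (≅F-sym p)
    ≅F-sym (≅.swap e₁ e₂ p) = ≅.swap (≅T-sym e₂) (≅T-sym e₁) (≅F-sym p)
    ≅F-sym (≅.trans p q) = ≅.trans (≅F-sym q) (≅F-sym p)

    pointwise-sym : ∀ {F F′} → Pointwise _≅T_ F F′ → Pointwise _≅T_ F′ F
    pointwise-sym [] = []
    pointwise-sym (e ∷ ps) = ≅T-sym e ∷ pointwise-sym ps

  ↭⇒≅F : ∀ {F G} → F ↭ G → F ≅F G
  ↭⇒≅F ↭.refl = ≅F-refl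
  ↭⇒≅F (↭.prep t p) = ≅.prep ≅T-refl (↭⇒≅F p)
  ↭⇒≅F (↭.swap t u p) = ≅.swap ≅T-refl ≅T-refl (↭⇒≅F p)
  ↭⇒≅F (↭.trans p q) = ≅.trans (↭⇒≅F p) (↭⇒≅F q)

  ≅F-length : ∀ {F G} → F ≅F G → length F ≡ length G
  ≅F-length (≅.refl ps) = pointwise-length ps
    where
    pointwise-length : ∀ {F G} → Pointwise _≅T_ F G → length F ≡ length G
    pointwise-length [] = refl
    pointwise-length (_ ∷ ps) = cong suc (pointwise-length ps)
  ≅F-length (≅.prep _ p) = cong suc (≅F-length p)
  ≅F-length (≅.swap _ _ p) = cong (λ n → suc (suc n)) (≅F-length p)
  ≅F-length (≅.trans p q) = trans (≅F-length p) (≅F-length q)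

  ∈⇒↭ : ∀ {A : Set} {x : A} {xs} → x ∈ xs → Σ[ ys ∈ List A ] xs ↭ x ∷ ys
  ∈⇒↭ x∈xs with ys , zs , refl ← ∈-∃++ x∈xs = ys ++ zs , ↭-shift _ ys zs

  module Products (π : Tree → Poly) (Π : Forest → Poly) (Π-∷ : ∀ t ts → Π (t ∷ ts) ↭ mul (π t) (Π ts)) where

    Π-swap : ∀ t u F → Π (t ∷ u ∷ F) ↭ Π (u ∷ t ∷ F)
    Π-swap t u F = begin
      Π (t ∷ u ∷ F)                  ↭⟨ ↭-trans (Π-∷ t (u ∷ F)) (mul-congˡ (π t) (Π-∷ u F)) ⟩
      mul (π t) (mul (π u) (Π F))    ↭⟨ mul-swap (π t) (π u) (Π F) ⟩
      mul (π u) (mul (π t) (Π F))    ↭⟨ ↭-trans (Π-∷ u (t ∷ F)) (mul-congˡ (π u) (Π-∷ t F)) ⟨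
      Π (u ∷ t ∷ F)                  ∎
      where open PermutationReasoning

    Π-prep : ∀ t {F G} → Π F ↭ Π G → Π (t ∷ F) ↭ Π (t ∷ G)
    Π-prep t {F} {G} e = ↭-trans (Π-∷ t F) (↭-trans (mul-congˡ (π t) e) (↭-sym (Π-∷ t G)))

    Π-resp-↭ : ∀ {F G} → F ↭ G → Π F ↭ Π G
    Π-resp-↭ ↭.refl = ↭-refl
    Π-resp-↭ (↭.prep t F↭G) = Π-prep t (Π-resp-↭ F↭G)
    Π-resp-↭ (↭.swap t u F↭G) = ↭-trans (Π-prep t (Π-prep u (Π-resp-↭ F↭G))) (Π-swap t u _)
    Π-resp-↭ (↭.trans F↭G G↭H) = ↭-trans (Π-resp-↭ F↭G) (Π-resp-↭ G↭H)

  module Invariance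
    (π : Tree → Poly) (Π : Forest → Poly)
    (Π-∷ : ∀ t ts → Π (t ∷ ts) ↭ mul (π t) (Π ts))
    (π-node : ∀ {cs ds} → cs ≅F ds → Π cs ↭ Π ds → π (node cs) ↭ π (node ds))
    where

    open Products π Π Π-∷

    mutual
      π-resp-≅ : ∀ {T T′} → T ≅T T′ → π T ↭ π T′
      π-resp-≅ (node p) = π-node p (Π-resp-≅ p)

      Π-resp-≅ : ∀ {F F′} → F ≅F F′ → Π F ↭ Π F′
      Π-resp-≅ (≅.refl ps) = Π-resp-pointwise ps
      Π-resp-≅ (≅.prep e p) = prepend e (Π-resp-≅ p)
      Π-resp-≅ (≅.swap {ys = ys} {x′ = x′} {y′} e₁ e₂ p) =
        ↭-trans (prepend e₁ (prepend e₂ (Π-resp-≅ p))) (Π-swap x′ y′ ys)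
      Π-resp-≅ (≅.trans p q) = ↭-trans (Π-resp-≅ p) (Π-resp-≅ q)

      Π-resp-pointwise : ∀ {F F′} → Pointwise _≅T_ F F′ → Π F ↭ Π F′
      Π-resp-pointwise [] = ↭-refl
      Π-resp-pointwise (e ∷ ps) = prepend e (Π-resp-pointwise ps)

      prepend : ∀ {t t′ ts ts′} → t ≅T t′ → Π ts ↭ Π ts′ → Π (t ∷ ts) ↭ Π (t′ ∷ ts′)
      prepend {t} {t′} {ts} {ts′} e p = begin
        Π (t ∷ ts)            ↭⟨ Π-∷ t ts ⟩
        mul (π t) (Π ts)      ↭⟨ mul-cong (π-resp-≅ e) p ⟩
        mul (π t′) (Π ts′)    ↭⟨ Π-∷ t′ ts′ ⟨
        Π (t′ ∷ ts′)          ∎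
        where open PermutationReasoning

  record SeparatingPoint (π : Tree → Poly) (weight : Tree → ℕ) (T : Tree) : Set where
    field
      X Y : Series
      vanishes : ev X Y (π T) ≈ 0S
      separates : ∀ T′ → weight T′ ≤ weight T → ev X Y (π T′) ≈ 0S → π T′ ↭ π T

  module Completeness
    (π : Tree → Poly) (Π : Forest → Poly)
    (Π-[] : Π [] ↭ one)
    (Π-∷ : ∀ t ts → Π (t ∷ ts) ↭ mul (π t) (Π ts))
    (π-nonzero : ∀ T → ¬ (π T ↭ []))
    (π-children : ∀ {cs ds} → π (node cs) ↭ π (node ds) → Π cs ↭ Π ds)
    (weight : Tree → ℕ)
    (separating-point : ∀ T → SeparatingPoint π weight T)
    where

    open Products π Π Π-∷

    private
      ev-Π-∷ : ∀ {X Y} t ts → ev X Y (Π (t ∷ ts)) ≈ ev X Y (π t) ⊛ ev X Y (Π ts)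
      ev-Π-∷ t ts = ≈-trans (ev-↭ (Π-∷ t ts)) (ev-mul (π t) (Π ts))

      vanishes-on-Π : ∀ {T F} (s : SeparatingPoint π weight T) → T ∈ F →
                      ev (SeparatingPoint.X s) (SeparatingPoint.Y s) (Π F) ≈ 0S
      vanishes-on-Π {T} s T∈F with F′ , F↭ ← ∈⇒↭ T∈F = begin
        ev X Y (Π _)                  ≈⟨ ev-↭ (Π-resp-↭ F↭) ⟩
        ev X Y (Π (T ∷ F′))           ≈⟨ ev-Π-∷ T F′ ⟩
        ev X Y (π T) ⊛ ev X Y (Π F′)  ≈⟨ ⊛-congʳ (ev X Y (Π F′)) vanishes ⟩
        0S ⊛ ev X Y (Π F′)            ≈⟨ ⊛-zeroˡ (ev X Y (Π F′)) ⟩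
        0S                            ∎
        where
        open SeparatingPoint s
        open import Relation.Binary.Reasoning.Setoid (CommutativeRing.setoid ring)

      nonvanishing-on-Π : ∀ {X Y} F → All (λ T → ¬ ev X Y (π T) ≈ 0S) F → ¬ ev X Y (Π F) ≈ 0S
      nonvanishing-on-Π {X} {Y} [] [] Π≈0 = ℚ.1≢0 (trans (sym (ev-one {X} {Y} 0)) (trans (sym (ev-↭ Π-[] 0)) (Π≈0 0)))
      nonvanishing-on-Π (t ∷ ts) (t≉0 ∷ ts≉0) Π≈0 =
        nonvanishing-on-Π ts ts≉0 (zero-product _ _ (≈-trans (≈-sym (ev-Π-∷ t ts)) Π≈0) t≉0)

      Π-[]≭Π-∷ : ∀ t ts → ¬ (Π [] ↭ Π (t ∷ ts))
      Π-[]≭Π-∷ t ts e = nonvanishing-on-Π [] [] (≈-trans (ev-↭ e) (vanishes-on-Π (separating-point t) (here refl)))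

      heaviest : ∀ t ts → Σ[ T ∈ Tree ] T ∈ t ∷ ts × All (λ T′ → weight T′ ≤ weight T) (t ∷ ts)
      heaviest t ts = argmax weight t ts , member , f[⊥]≤f[argmax] {f = weight} t ts ∷ f[xs]≤f[argmax] {f = weight} t ts
        where
        member : argmax weight t ts ∈ t ∷ ts
        member with argmax-sel weight t ts
        ... | inj₁ T≡t = here T≡t
        ... | inj₂ T∈ts = there T∈ts

      split-bound : ∀ {a b c d k} → suc a + c + (suc b + d) ≤ suc k → b + a ≤ k × c + d ≤ k
      split-bound {a} {b} {c} {d} {k} bound = ℕ.≤-trans (ℕ.≤-reflexive (ℕ.+-comm b a)) (ℕ.≤-trans (ℕ.+-mono-≤ (ℕ.m≤m+n a c) (ℕ.m≤m+n b d)) total)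
                                            , ℕ.≤-trans (ℕ.+-mono-≤ (ℕ.m≤n+m c a) (ℕ.m≤n+m d b)) total
        where
        total : a + c + (b + d) ≤ k
        total = ℕ.≤-trans (ℕ.+-monoʳ-≤ (a + c) (ℕ.n≤1+n (b + d))) (ℕ.≤-pred bound)

    CompleteBelow : ℕ → Set
    CompleteBelow k = ∀ F₁ F₂ → sizeF F₁ + sizeF F₂ ≤ k → Π F₁ ↭ Π F₂ → F₁ ≅F F₂

    -- The separating point of T kills Π F₁ = Π F₂, so some factor π T′ of Π F₂ vanishes
    -- there; as T′ is no heavier than T, π T′ ↭ π T, which is then cancelled.
    match-heaviest : ∀ {k} → CompleteBelow k → ∀ {T F₁ F₂} → T ∈ F₁ → All (λ T′ → weight T′ ≤ weight T) F₂ →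
                     sizeF F₁ + sizeF F₂ ≤ suc k → Π F₁ ↭ Π F₂ → F₁ ≅F F₂
    match-heaviest {k} ih {node cs} {F₁} {F₂} T∈F₁ F₂≤T bound e
      with F₁′ , F₁↭ ← ∈⇒↭ T∈F₁ | any? (λ T′ → π T′ ↭? π (node cs)) F₂
    ... | no none = ⊥-elim (nonvanishing-on-Π F₂ F₂-nonvanishing (≈-trans (ev-↭ (↭-sym e)) (vanishes-on-Π s T∈F₁)))
      where
      s = separating-point (node cs)
      open SeparatingPoint s
      F₂-nonvanishing : All (λ T′ → ¬ ev X Y (π T′) ≈ 0S) F₂
      F₂-nonvanishing = All.zipWith (λ (T′≭T , T′≤T) vanishing → T′≭T (separates _ T′≤T vanishing))
                                    (¬Any⇒All¬ F₂ none , F₂≤T)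
    ... | yes some with node ds , T′∈F₂ , T′↭T ← find some with F₂′ , F₂↭ ← ∈⇒↭ T′∈F₂ =
      ≅.trans (↭⇒≅F F₁↭) (≅.trans (≅.prep (≅T-sym (node (ih ds cs children-bound (π-children T′↭T)))) rest) (↭⇒≅F (↭-sym F₂↭)))
      where
      sizes : suc (sizeF cs) + sizeF F₁′ + (suc (sizeF ds) + sizeF F₂′) ≤ suc k
      sizes = subst (_≤ suc k) (cong₂ _+_ (sizeF-↭ F₁↭) (sizeF-↭ F₂↭)) bound
      children-bound : sizeF ds + sizeF cs ≤ k
      children-bound = proj₁ (split-bound {sizeF cs} {sizeF ds} {sizeF F₁′} {sizeF F₂′} sizes)
      rest : F₁′ ≅F F₂′
      rest = ih F₁′ F₂′ (proj₂ (split-bound {sizeF cs} {sizeF ds} {sizeF F₁′} {sizeF F₂′} sizes)) (mul-cancelˡ (π-nonzero (node cs)) (begin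
        mul (π (node cs)) (Π F₁′)   ↭⟨ Π-∷ (node cs) F₁′ ⟨
        Π (node cs ∷ F₁′)           ↭⟨ Π-resp-↭ F₁↭ ⟨
        Π F₁                        ↭⟨ e ⟩
        Π F₂                        ↭⟨ Π-resp-↭ F₂↭ ⟩
        Π (node ds ∷ F₂′)           ↭⟨ Π-∷ (node ds) F₂′ ⟩
        mul (π (node ds)) (Π F₂′)   ↭⟨ mul-congʳ (Π F₂′) T′↭T ⟩
        mul (π (node cs)) (Π F₂′)   ∎))
        where open PermutationReasoning

    complete-below : ∀ k → CompleteBelow k
    complete-below k [] [] _ _ = ≅.refl []
    complete-below k [] (u ∷ us) _ e = ⊥-elim (Π-[]≭Π-∷ u us e)
    complete-below k (t ∷ ts) [] _ e = ⊥-elim (Π-[]≭Π-∷ t ts (↭-sym e))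
    complete-below zero (node cs ∷ ts) (u ∷ us) () e
    complete-below (suc k) (t ∷ ts) (u ∷ us) bound e
      with T₁ , T₁∈ , F₁≤T₁ ← heaviest t ts | T₂ , T₂∈ , F₂≤T₂ ← heaviest u us | weight T₂ ℕ.≤? weight T₁
    ... | yes T₂≤T₁ =
      match-heaviest (complete-below k) T₁∈ (All.map (λ w≤ → ℕ.≤-trans w≤ T₂≤T₁) F₂≤T₂) bound e
    ... | no T₂≰T₁ =
      ≅F-sym (match-heaviest (complete-below k) T₂∈ (All.map (λ w≤ → ℕ.≤-trans w≤ (ℕ.<⇒≤ (ℕ.≰⇒> T₂≰T₁))) F₁≤T₁)
                             (subst (_≤ suc k) (ℕ.+-comm (sizeF (t ∷ ts)) _) bound) (↭-sym e))

    complete : ∀ F₁ F₂ → Π F₁ ↭ Π F₂ → F₁ ≅F F₂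
    complete F₁ F₂ = complete-below _ F₁ F₂ ℕ.≤-refl

module SubtreePolynomial where

  open import Data.Empty using (⊥-elim)
  open import Data.List using ([]; _∷_; map; _++_)
  open import Data.List.Relation.Binary.Permutation.Propositional as ↭
    using (_↭_; ↭-refl; ↭-prep; ↭-swap; ↭-sym; ↭-trans; module PermutationReasoning)
  open import Data.List.Relation.Binary.Permutation.Propositional.Properties using (map⁺; ++⁺; drop-∷; All-resp-↭)
  import Data.List.Relation.Unary.All.Properties as All
  open import Data.List.Relation.Unary.All as All using (All; []; _∷_)
  open import Data.Nat using (ℕ; zero; suc; _+_; _<_; _≤_; z≤n; s≤s; _⊔_)
  import Data.Nat.Properties as ℕ
  open import Data.Product using (_×_; _,_; proj₁; proj₂; Σ-syntax)
  open import Data.Rational as ℚ using (ℚ; 0ℚ; 1ℚ)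
  import Data.Rational.Properties as ℚ
  import Data.Rational.Solver
  open import Data.Sum using (inj₁; inj₂)
  open import Relation.Binary.PropositionalEquality
  open import Relation.Nullary using (¬_)
  open import Function.Bundles using (_⇔_; mk⇔)
  open PowerSeries
  open Truncation
  open Hensel
  open Polynomial
  open Evaluation
  open Forests

  module _ {n φ} (φ≈0 : φ ≈[ n ] 0S) (φₙ≢0 : φ n ≢ 0ℚ) where

    private
      φ≉0 : ¬ φ ≈ 0S
      φ≉0 φ≈0′ = φₙ≢0 (φ≈0′ n)

      y⁰-parts-agree : ∀ A B → ev 𝕥 φ A ≈ ev 𝕥 φ B → ev 𝕥 φ (y⁰-part A) ≈[ n ] ev 𝕥 φ (y⁰-part B)
      y⁰-parts-agree A B e i i<n = begin
        ev 𝕥 φ (y⁰-part A) i                                       ≡⟨ ℚ.+-identityʳ _ ⟨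
        ev 𝕥 φ (y⁰-part A) i ℚ.+ 0ℚ                                ≡⟨ cong (ev 𝕥 φ (y⁰-part A) i ℚ.+_) (⊛-vanishesˡ n (ev 𝕥 φ (y-quotient A)) φ≈0 i i<n) ⟨
        (ev 𝕥 φ (y⁰-part A) ⊕ φ ⊛ ev 𝕥 φ (y-quotient A)) i        ≡⟨ trans (sym (ev-split A i)) (trans (e i) (ev-split B i)) ⟩
        (ev 𝕥 φ (y⁰-part B) ⊕ φ ⊛ ev 𝕥 φ (y-quotient B)) i        ≡⟨ cong (ev 𝕥 φ (y⁰-part B) i ℚ.+_) (⊛-vanishesˡ n (ev 𝕥 φ (y-quotient B)) φ≈0 i i<n) ⟩
        ev 𝕥 φ (y⁰-part B) i ℚ.+ 0ℚ                                ≡⟨ ℚ.+-identityʳ _ ⟩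
        ev 𝕥 φ (y⁰-part B) i                                       ∎
        where open ≡-Reasoning

    -- x^a y^b ↦ t^a φ^b has order a + n b, so for a < n nothing can cancel.
    ev-𝕥-injective : ∀ {A B} → XBounded n A → XBounded n B → ev 𝕥 φ A ≈ ev 𝕥 φ B → A ↭ B
    ev-𝕥-injective {A} {B} A<n B<n =
      below (bound proj₂ A ⊔ bound proj₂ B) A<n B<n (proj₁ (common-bound proj₂ A B)) (proj₂ (common-bound proj₂ A B))
      where
      below : ∀ K {A B} → XBounded n A → XBounded n B → YBounded K A → YBounded K B → ev 𝕥 φ A ≈ ev 𝕥 φ B → A ↭ B
      below zero {[]} {[]} _ _ _ _ _ = ↭-refl
      below zero {_ ∷ _} _ _ (() ∷ _) _ _
      below zero {[]} {_ ∷ _} _ _ _ (() ∷ _) _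
      below (suc K) {A} {B} A<n B<n A<K B<K e = begin
          A                                         ↭⟨ y-split A ⟩
          y⁰-part A ++ map raiseY (y-quotient A)    ↭⟨ ++⁺ y⁰-parts (map⁺ raiseY quotients) ⟩
          y⁰-part B ++ map raiseY (y-quotient B)    ↭⟨ y-split B ⟨
          B                                         ∎
        where
        open PermutationReasoning
        y⁰-parts : y⁰-part A ↭ y⁰-part B
        y⁰-parts = y-free-injective (y⁰-part-y-free A) (y⁰-part-y-free B)
                     (y⁰-part-XBounded A A<n) (y⁰-part-XBounded B B<n) (y⁰-parts-agree A B e)
        quotients : y-quotient A ↭ y-quotient B
        quotients = below K (y-quotient-XBounded A A<n) (y-quotient-XBounded B B<n)
                      (y-quotient-YBounded A A<K) (y-quotient-YBounded B B<K)
                      (⊛-cancelˡ φ≉0 (⊕-cancelˡ (ev 𝕥 φ (y⁰-part A)) _ _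
                        (≈-trans (≈-sym (ev-split A)) (≈-trans e (≈-trans (ev-split B) (⊕-congʳ _ (ev-↭ (↭-sym y⁰-parts))))))))

    vanishing-XBounded : ∀ {p} → XBounded n p → ev 𝕥 φ p ≈ 0S → p ↭ []
    vanishing-XBounded p<n p≈0 = ev-𝕥-injective p<n [] p≈0

    vanishing-Leading : ∀ {b p q} → Leading proj₁ (n , b) p → Leading proj₁ (n , b) q →
                        ev 𝕥 φ p ≈ 0S → ev 𝕥 φ q ≈ 0S → p ↭ q
    vanishing-Leading {b} {p} {q} (leading lo split lo<) (leading lo′ split′ lo′<) p≈0 q≈0 =
      ↭-trans split (↭-trans (↭-prep (n , b) (ev-𝕥-injective lo< lo′< lower-parts)) (↭-sym split′))
      where
      lower-parts : ev 𝕥 φ lo ≈ ev 𝕥 φ lo′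
      lower-parts = ⊕-cancelˡ (monomial 𝕥 φ (n , b)) _ _
                      (≈-trans (≈-sym (ev-↭ split)) (≈-trans p≈0 (≈-trans (≈-sym q≈0) (ev-↭ split′))))

    vanishing-Leading-≤ : ∀ {n′ p q} → n′ ≤ n → Leading proj₁ (n′ , 0) p → Leading proj₁ (n , 0) q →
                          ev 𝕥 φ p ≈ 0S → ev 𝕥 φ q ≈ 0S → p ↭ q
    vanishing-Leading-≤ n′≤n p-lead q-lead p≈0 q≈0 with ℕ.m≤n⇒m<n∨m≡n n′≤n
    ... | inj₂ refl = vanishing-Leading p-lead q-lead p≈0 q≈0
    ... | inj₁ n′<n with leading lo split lo< ← p-lead =
      ⊥-elim (Leading-nonzero p-lead
        (vanishing-XBounded (All-resp-↭ (↭-sym split) (n′<n ∷ Bounded-weaken (ℕ.<⇒≤ n′<n) lo<)) p≈0))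

  ev-ST : ∀ {X Y} cs → ev X Y (ST (node cs)) ≈ Y ⊕ X ⊛ ev X Y (SFo cs)
  ev-ST {X} {Y} cs = ⊕-cong (≈-trans (⊛-identityˡ (Y ⊛ 1S)) (⊛-identityʳ Y)) (ev-raiseX (SFo cs))

  mutual
    ST-linear : ∀ T → HasLinearPart (λ a → ev 𝕥 a (ST T)) 1ℚ 0ℚ
    ST-linear (node cs) with c , φ₀ , L ← SFo-linear cs =
      linear-ext (λ a → ≈-sym (ev-ST cs))
        (linear-resp (solve 2 (λ c φ → con 1ℚ :+ (con 0ℚ :* c :+ φ :* con 0ℚ) := con 1ℚ) refl c φ₀)
                     (solve 1 (λ φ → con 0ℚ :+ con 0ℚ :* φ := con 0ℚ) refl φ₀)
                     (linear-⊕ linear-id (linear-⊛ (linear-const 𝕥) L)))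
      where open Data.Rational.Solver.+-*-Solver

    SFo-linear : ∀ F → Σ[ c ∈ ℚ ] Σ[ φ₀ ∈ ℚ ] HasLinearPart (λ a → ev 𝕥 a (SFo F)) c φ₀
    SFo-linear [] = _ , _ , linear-ext (λ a → ≈-sym (ev-one {𝕥} {a})) (linear-const 1S)
    SFo-linear (t ∷ ts) with _ , _ , L ← SFo-linear ts =
      _ , _ , linear-ext (λ a → ≈-sym (ev-mul (ST t) (SFo ts))) (linear-⊛ (ST-linear t) L)

  mutual
    ST-at-y=0 : ∀ {X} T → ev X 0S (ST T) ≈ X ^ size T
    ST-at-y=0 {X} (node cs) =
      ≈-trans (ev-ST cs) (≈-trans (λ i → ℚ.+-identityˡ _) (⊛-congˡ X (SFo-at-y=0 cs)))

    SFo-at-y=0 : ∀ {X} F → ev X 0S (SFo F) ≈ X ^ sizeF F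
    SFo-at-y=0 {X} [] = ev-one {X} {0S}
    SFo-at-y=0 {X} (t ∷ ts) =
      ≈-trans (ev-mul (ST t) (SFo ts)) (≈-trans (⊛-cong (ST-at-y=0 t) (SFo-at-y=0 ts)) (≈-sym (^-homo-* X (size t) (sizeF ts))))

  mutual
    ST-leading : ∀ T → Leading proj₁ (size T , 0) (ST T)
    ST-leading (node cs) with leading lo split lo< ← SFo-leading cs =
      leading ((0 , 1) ∷ map raiseX lo)
              (↭-trans (↭-prep (0 , 1) (map⁺ raiseX split)) (↭-swap (0 , 1) (size (node cs) , 0) ↭-refl))
              (s≤s z≤n ∷ All.map⁺ (All.map s≤s lo<))

    SFo-leading : ∀ F → Leading proj₁ (sizeF F , 0) (SFo F)
    SFo-leading [] = leading [] ↭-refl []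
    SFo-leading (t ∷ ts) = Leading-mul proj₁ (λ _ _ → refl) (ST-leading t) (SFo-leading ts)

  ST-children : ∀ {cs ds} → ST (node cs) ↭ ST (node ds) → SFo cs ↭ SFo ds
  ST-children e = map-injective-↭ (λ {m} {m′} → raiseX-injective m m′) (drop-∷ e)
    where
    raiseX-injective : ∀ m m′ → raiseX m ≡ raiseX m′ → m ≡ m′
    raiseX-injective (a , b) (.a , .b) refl = refl

  -- The root of y ↦ S_T(t, y) vanishes to order |T|: it is -t^|T| + ….
  ST-separating-point : ∀ T → SeparatingPoint ST size T
  ST-separating-point (node cs) = record
    { X = 𝕥
    ; Y = root
    ; vanishes = root-vanishes
    ; separates = separates
    }
    where
    open Root ℚ.1≢0 (ST-linear (node cs))
    n : ℕ
    n = size (node cs)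
    order : root ≈[ n ] 0S × root n ≢ 0ℚ
    order = root-order (s≤s z≤n) (ST-at-y=0 (node cs))
    separates : ∀ T′ → size T′ ≤ n → ev 𝕥 root (ST T′) ≈ 0S → ST T′ ↭ ST (node cs)
    separates T′ T′≤T T′≈0 =
      vanishing-Leading-≤ (proj₁ order) (proj₂ order) T′≤T (ST-leading T′) (ST-leading (node cs)) T′≈0 root-vanishes

  SFo-complete-invariant : ∀ F₁ F₂ → (SFo F₁ ≈P SFo F₂) ⇔ (F₁ ≅F F₂)
  SFo-complete-invariant F₁ F₂ = mk⇔
    (λ e → complete F₁ F₂ (≈P⇒↭ (SFo F₁) (SFo F₂) e))
    (λ F₁≅F₂ → ↭⇒≈P (Π-resp-≅ F₁≅F₂))
    where
    open Invariance ST SFo (λ _ _ → ↭-refl) (λ _ children → ↭-prep (0 , 1) (map⁺ raiseX children))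
    open Completeness ST SFo ↭-refl (λ _ _ → ↭-refl) (λ T → Leading-nonzero (ST-leading T)) (λ {cs} {ds} → ST-children {cs} {ds})
                      size ST-separating-point

module LeafPolynomial where

  open import Algebra.Bundles using (CommutativeRing)
  open import Data.Empty using (⊥-elim)
  open import Data.List using ([]; _∷_; map; _++_; replicate)
  open import Data.List.Relation.Binary.Permutation.Propositional as ↭
    using (_↭_; ↭-refl; ↭-reflexive; ↭-prep; ↭-swap; ↭-sym; ↭-trans; module PermutationReasoning)
  open import Data.List.Relation.Binary.Permutation.Propositional.Properties
    using (¬x∷xs↭[]; map⁺; ++⁺; ++⁺ˡ; All-resp-↭; ∈-resp-↭) renaming (shift to ↭-shift)
  open import Data.List.Relation.Unary.Any using (here; there)
  open import Data.List.Relation.Unary.All as All using (All; []; _∷_)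
  import Data.List.Relation.Unary.All.Properties as All
  open import Data.Nat using (ℕ; zero; suc; _+_; _<_; _≤_; z≤n; s≤s; _≟_; _⊔_)
  import Data.Nat.Properties as ℕ
  open import Data.Product using (_×_; _,_; proj₁; proj₂; Σ-syntax)
  open import Data.Rational as ℚ using (ℚ; 0ℚ; 1ℚ)
  import Data.Rational.Properties as ℚ
  open import Data.Rational.Solver using (module +-*-Solver)
  open import Data.Sum using (inj₁; inj₂)
  open import Function.Base using (_∘_)
  open import Function.Bundles using (_⇔_; mk⇔)
  open import Relation.Binary.PropositionalEquality
  open import Relation.Nullary using (¬_; yes; no)
  open PowerSeries
  open Truncation
  open Hensel
  open Polynomial
  open Evaluation
  open Forests

  𝕫 : Series
  𝕫 = 𝕥 ⊕ ⊝ 1S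

  private
    𝕫^-step : ∀ b i → (𝕫 ^ suc b) i ≡ shift (𝕫 ^ b) i ℚ.- (𝕫 ^ b) i
    𝕫^-step b i = trans (⊛-distribʳ 𝕥 (⊝ 1S) (𝕫 ^ b) i)
                        (cong₂ ℚ._+_ (𝕥⊛ (𝕫 ^ b) i) (trans (sym (-‿distribˡ-* 1S (𝕫 ^ b) i)) (cong ℚ.-_ (⊛-identityˡ (𝕫 ^ b) i))))
      where open import Algebra.Properties.Ring (CommutativeRing.ring ring) using (-‿distribˡ-*)

  𝕫^-beyond : ∀ {b i} → b < i → (𝕫 ^ b) i ≡ 0ℚ
  𝕫^-beyond {zero} {suc i} _ = refl
  𝕫^-beyond {suc b} {suc i} (s≤s b<i) =
    trans (𝕫^-step b (suc i)) (trans (cong₂ ℚ._-_ (𝕫^-beyond b<i) (𝕫^-beyond (ℕ.m<n⇒m<1+n b<i))) (ℚ.+-inverseʳ 0ℚ))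

  𝕫^-top : ∀ b → (𝕫 ^ b) b ≡ 1ℚ
  𝕫^-top zero = refl
  𝕫^-top (suc b) = trans (𝕫^-step b (suc b)) (trans (cong₂ ℚ._-_ (𝕫^-top b) (𝕫^-beyond (ℕ.n<1+n b))) (ℚ.+-identityʳ 1ℚ))

  -- (t - 1)^b has degree b and leading coefficient 1, so the top coefficient counts the y^L.
  private
    y-count-coefficient : ∀ {X} L u → XBounded 1 u → YBounded (suc L) u → ev X 𝕫 u L ≡ fromℕ (y-count L u)
    y-count-coefficient L [] [] [] = refl
    y-count-coefficient {X} L ((.0 , b) ∷ u) (s≤s z≤n ∷ u-free) (b≤L ∷ u≤L) with b ≟ L
    ... | yes refl = cong₂ ℚ._+_ (trans (⊛-identityˡ (𝕫 ^ b) b) (𝕫^-top b)) (y-count-coefficient L u u-free u≤L)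
    ... | no b≢L = trans (cong₂ ℚ._+_ (trans (⊛-identityˡ (𝕫 ^ b) L) (𝕫^-beyond (ℕ.≤∧≢⇒< (ℕ.≤-pred b≤L) b≢L)))
                                     (y-count-coefficient L u u-free u≤L))
                         (ℚ.+-identityˡ _)

  y-only-injective : ∀ ℓ {X u v} → XBounded 1 u → XBounded 1 v → YBounded ℓ u → YBounded ℓ v →
                     ev X 𝕫 u ≈[ ℓ ] ev X 𝕫 v → u ↭ v
  y-only-injective zero {u = []} {[]} _ _ _ _ _ = ↭-refl
  y-only-injective zero {u = _ ∷ _} _ _ (() ∷ _) _ _
  y-only-injective zero {u = []} {_ ∷ _} _ _ _ (() ∷ _) _
  y-only-injective (suc L) {X} {u} {v} u-free v-free u≤L v≤L e = begin
      u                          ↭⟨ y-top-split L u u-free ⟩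
      replicate k (0 , L) ++ y-below L u   ↭⟨ ++⁺ˡ (replicate k (0 , L)) lower ⟩
      replicate k (0 , L) ++ y-below L v   ≡⟨ cong (λ n → replicate n (0 , L) ++ y-below L v) counts ⟩
      replicate (y-count L v) (0 , L) ++ y-below L v   ↭⟨ y-top-split L v v-free ⟨
      v                          ∎
    where
    open PermutationReasoning
    k = y-count L u
    counts : k ≡ y-count L v
    counts = fromℕ-injective (trans (sym (y-count-coefficient L u u-free u≤L))
                                    (trans (e L ℕ.≤-refl) (y-count-coefficient L v v-free v≤L)))
    split : ∀ w → XBounded 1 w → ev X 𝕫 w ≈ ev X 𝕫 (replicate (y-count L w) (0 , L)) ⊕ ev X 𝕫 (y-below L w)
    split w w-free = ≈-trans (ev-↭ (y-top-split L w w-free)) (ev-++ (replicate (y-count L w) (0 , L)) (y-below L w))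
    lower : y-below L u ↭ y-below L v
    lower = y-only-injective L (y-below-XBounded L u u-free) (y-below-XBounded L v v-free)
              (y-below-YBounded L u u≤L) (y-below-YBounded L v v≤L)
              λ i i<L → ℚ-cancelˡ (ev X 𝕫 (replicate k (0 , L)) i) _ _
                (trans (sym (split u u-free i))
                (trans (e i (ℕ.m<n⇒m<1+n i<L))
                (trans (split v v-free i)
                       (cong (λ n → ev X 𝕫 (replicate n (0 , L)) i ℚ.+ ev X 𝕫 (y-below L v) i) (sym counts)))))
      where open import Algebra.Properties.Group ℚ.+-0-group using () renaming (∙-cancelˡ to ℚ-cancelˡ)

  1⊖_ : Series → Series
  1⊖ σ = 1S ⊕ ⊝ σ

  ev-at-x=1 : ∀ {σ Y} p → ev (1⊖ σ) Y (at-x=1 p) ≈ ev (1⊖ σ) Y p ⊕ σ ⊛ ev (1⊖ σ) Y (x-diff p)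
  ev-at-x=1 {σ} {Y} p i = begin
      A i                              ≡⟨ solve 4 (λ a d s q → a := (a :+ (d :- s)) :- d :+ s) refl (A i) (D i) ((σ ⊛ D) i) (P i) ⟩
      A i ℚ.+ (D i ℚ.- (σ ⊛ D) i) ℚ.- D i ℚ.+ (σ ⊛ D) i   ≡⟨ cong (λ z → z ℚ.- D i ℚ.+ (σ ⊛ D) i) telescoped ⟩
      P i ℚ.+ D i ℚ.- D i ℚ.+ (σ ⊛ D) i                    ≡⟨ solve 3 (λ q d s → q :+ d :- d :+ s := q :+ s) refl (P i) (D i) ((σ ⊛ D) i) ⟩
      P i ℚ.+ (σ ⊛ D) i                                    ∎
    where
    open ≡-Reasoning
    open +-*-Solver
    open import Algebra.Properties.Ring (CommutativeRing.ring ring) using (-‿distribˡ-*)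
    X = 1⊖ σ
    A = ev X Y (at-x=1 p)
    P = ev X Y p
    D = ev X Y (x-diff p)
    X⊛D : X ⊛ D ≈ D ⊕ ⊝ (σ ⊛ D)
    X⊛D = ≈-trans (⊛-distribʳ 1S (⊝ σ) D) (⊕-cong (⊛-identityˡ D) (≈-sym (-‿distribˡ-* σ D)))
    telescoped : A i ℚ.+ (D i ℚ.- (σ ⊛ D) i) ≡ P i ℚ.+ D i
    telescoped = begin
      A i ℚ.+ (D i ℚ.- (σ ⊛ D) i)                                 ≡⟨ cong (A i ℚ.+_) (X⊛D i) ⟨
      A i ℚ.+ (X ⊛ D) i                                           ≡⟨ cong (A i ℚ.+_) (ev-raiseX (x-diff p) i) ⟨
      A i ℚ.+ ev X Y (map raiseX (x-diff p)) i                    ≡⟨ ev-++ (at-x=1 p) (map raiseX (x-diff p)) i ⟨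
      ev X Y (at-x=1 p ++ map raiseX (x-diff p)) i                ≡⟨ ev-↭ (telescope p) i ⟩
      ev X Y (p ++ x-diff p) i                                    ≡⟨ ev-++ p (x-diff p) i ⟩
      P i ℚ.+ D i                                                 ∎

  module _ {ℓ σ} (σ≈0 : σ ≈[ ℓ ] 0S) (σℓ≢0 : σ ℓ ≢ 0ℚ) where

    private
      σ≉0 : ¬ σ ≈ 0S
      σ≉0 σ≈0′ = σℓ≢0 (σ≈0′ ℓ)

      at-x=1-agree : ∀ A B → ev (1⊖ σ) 𝕫 A ≈ ev (1⊖ σ) 𝕫 B → ev (1⊖ σ) 𝕫 (at-x=1 A) ≈[ ℓ ] ev (1⊖ σ) 𝕫 (at-x=1 B)
      at-x=1-agree A B e i i<ℓ = begin
        ev X 𝕫 (at-x=1 A) i                             ≡⟨ ev-at-x=1 A i ⟩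
        ev X 𝕫 A i ℚ.+ (σ ⊛ ev X 𝕫 (x-diff A)) i        ≡⟨ cong₂ ℚ._+_ (e i) (⊛-vanishesˡ ℓ (ev X 𝕫 (x-diff A)) σ≈0 i i<ℓ) ⟩
        ev X 𝕫 B i ℚ.+ 0ℚ                               ≡⟨ cong (ev X 𝕫 B i ℚ.+_) (⊛-vanishesˡ ℓ (ev X 𝕫 (x-diff B)) σ≈0 i i<ℓ) ⟨
        ev X 𝕫 B i ℚ.+ (σ ⊛ ev X 𝕫 (x-diff B)) i        ≡⟨ ev-at-x=1 B i ⟨
        ev X 𝕫 (at-x=1 B) i                             ∎
        where
        open ≡-Reasoning
        X = 1⊖ σ

    -- Writing x = 1 - σ, a polynomial is recovered from p(1, y), read off modulo t^ℓ,
    -- and from its x-difference quotient, by induction on the x-degree.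
    ev-1⊖-injective : ∀ {A B} → YBounded ℓ A → YBounded ℓ B → ev (1⊖ σ) 𝕫 A ≈ ev (1⊖ σ) 𝕫 B → A ↭ B
    ev-1⊖-injective {A} {B} =
      below (bound proj₁ A ⊔ bound proj₁ B) (proj₁ (common-bound proj₁ A B)) (proj₂ (common-bound proj₁ A B))
      where
      X = 1⊖ σ
      below : ∀ K {A B} → XBounded K A → XBounded K B → YBounded ℓ A → YBounded ℓ B → ev X 𝕫 A ≈ ev X 𝕫 B → A ↭ B
      below zero {[]} {[]} _ _ _ _ _ = ↭-refl
      below zero {_ ∷ _} (() ∷ _) _ _ _ _
      below zero {[]} {_ ∷ _} _ (() ∷ _) _ _ _
      below (suc K) {A} {B} A<K B<K A<ℓ B<ℓ e = ++-cancelʳ-↭ (x-diff A) (begin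
          A ++ x-diff A                        ↭⟨ telescope A ⟨
          at-x=1 A ++ map raiseX (x-diff A)    ↭⟨ ++⁺ at-x=1-parts (map⁺ raiseX diffs) ⟩
          at-x=1 B ++ map raiseX (x-diff B)    ↭⟨ telescope B ⟩
          B ++ x-diff B                        ↭⟨ ++⁺ˡ B (↭-sym diffs) ⟩
          B ++ x-diff A                        ∎)
        where
        open PermutationReasoning
        at-x=1-parts : at-x=1 A ↭ at-x=1 B
        at-x=1-parts = y-only-injective ℓ (at-x=1-x-free A) (at-x=1-x-free B)
                         (at-x=1-YBounded A A<ℓ) (at-x=1-YBounded B B<ℓ) (at-x=1-agree A B e)
        diffs : x-diff A ↭ x-diff B
        diffs = below K (x-diff-XBounded A A<K) (x-diff-XBounded B B<K) (x-diff-YBounded A A<ℓ) (x-diff-YBounded B B<ℓ)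
                  (⊛-cancelˡ σ≉0 (⊕-cancelˡ (ev X 𝕫 A) _ _
                    (≈-trans (≈-sym (ev-at-x=1 A)) (≈-trans (ev-↭ at-x=1-parts)
                    (≈-trans (ev-at-x=1 B) (⊕-congʳ _ (≈-sym e)))))))

    vanishing-YBounded : ∀ {p} → YBounded ℓ p → ev (1⊖ σ) 𝕫 p ≈ 0S → p ↭ []
    vanishing-YBounded p<ℓ p≈0 = ev-1⊖-injective p<ℓ [] p≈0

    vanishing-Leading : ∀ {a p q} → Leading proj₂ (a , ℓ) p → Leading proj₂ (a , ℓ) q →
                        ev (1⊖ σ) 𝕫 p ≈ 0S → ev (1⊖ σ) 𝕫 q ≈ 0S → p ↭ q
    vanishing-Leading {a} (leading lo split lo<) (leading lo′ split′ lo′<) p≈0 q≈0 =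
      ↭-trans split (↭-trans (↭-prep (a , ℓ) (ev-1⊖-injective lo< lo′< lower-parts)) (↭-sym split′))
      where
      lower-parts : ev (1⊖ σ) 𝕫 lo ≈ ev (1⊖ σ) 𝕫 lo′
      lower-parts = ⊕-cancelˡ (monomial (1⊖ σ) 𝕫 (a , ℓ)) _ _
                      (≈-trans (≈-sym (ev-↭ split)) (≈-trans p≈0 (≈-trans (≈-sym q≈0) (ev-↭ split′))))

    -- If ℓ′ < ℓ then p has y-degree < ℓ and would vanish identically.  If ℓ′ = ℓ then
    -- x^a p and x^b q share the leading monomial x^(a+b) y^ℓ, hence are equal, and at
    -- y = 0, where p and q are 1, this gives a = b.
    vanishing-Leading-≤ : ∀ {a b ℓ′ p q} → ℓ′ ≤ ℓ → Leading proj₂ (b , ℓ′) p → Leading proj₂ (a , ℓ) q →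
                          ev (1⊖ σ) 𝕫 p ≈ 0S → ev (1⊖ σ) 𝕫 q ≈ 0S → ev 𝕥 0S p ≈ 1S → ev 𝕥 0S q ≈ 1S → p ↭ q
    vanishing-Leading-≤ ℓ′≤ℓ p-lead q-lead p≈0 q≈0 p₀ q₀ with ℕ.m≤n⇒m<n∨m≡n ℓ′≤ℓ
    vanishing-Leading-≤ ℓ′≤ℓ p-lead@(leading lo split lo<) q-lead p≈0 q≈0 p₀ q₀ | inj₁ ℓ′<ℓ =
      ⊥-elim (Leading-nonzero p-lead
        (vanishing-YBounded (All-resp-↭ (↭-sym split) (ℓ′<ℓ ∷ Bounded-weaken (ℕ.<⇒≤ ℓ′<ℓ) lo<)) p≈0))
    vanishing-Leading-≤ {a} {b} {p = p} {q} ℓ′≤ℓ p-lead q-lead p≈0 q≈0 p₀ q₀ | inj₂ refl =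
      mul-cancelˡ {(a , 0) ∷ []} ¬x∷xs↭[] (subst (λ k → mul ((a , 0) ∷ []) p ↭ mul ((k , 0) ∷ []) q) (sym a≡b) shifted)
      where
      x^_·_ : ℕ → Poly → Poly
      x^ n · r = mul ((n , 0) ∷ []) r
      x^-leading : ∀ {n m r} → Leading proj₂ m r → Leading proj₂ ((n , 0) ⊹ m) (x^ n · r)
      x^-leading = Leading-mul proj₂ (λ _ _ → refl) (leading [] ↭-refl [])
      vanishes : ∀ n r → ev (1⊖ σ) 𝕫 r ≈ 0S → ev (1⊖ σ) 𝕫 (x^ n · r) ≈ 0S
      vanishes n r r≈0 = ≈-trans (ev-x^ n r) (≈-trans (⊛-congˡ _ r≈0) (⊛-zeroʳ _))
      shifted : x^ a · p ↭ x^ b · q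
      shifted = vanishing-Leading (x^-leading p-lead)
                  (subst (λ k → Leading proj₂ (k , ℓ) (x^ b · q)) (ℕ.+-comm b a) (x^-leading q-lead))
                  (vanishes a p p≈0) (vanishes b q q≈0)
      𝕥^a≈𝕥^b : 𝕥 ^ a ≈ 𝕥 ^ b
      𝕥^a≈𝕥^b = begin
        𝕥 ^ a                    ≈⟨ ⊛-identityʳ (𝕥 ^ a) ⟨
        𝕥 ^ a ⊛ 1S               ≈⟨ ⊛-congˡ (𝕥 ^ a) p₀ ⟨
        𝕥 ^ a ⊛ ev 𝕥 0S p        ≈⟨ ev-x^ a p ⟨
        ev 𝕥 0S (x^ a · p)       ≈⟨ ev-↭ shifted ⟩
        ev 𝕥 0S (x^ b · q)       ≈⟨ ev-x^ b q ⟩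
        𝕥 ^ b ⊛ ev 𝕥 0S q        ≈⟨ ⊛-congˡ (𝕥 ^ b) q₀ ⟩
        𝕥 ^ b ⊛ 1S               ≈⟨ ⊛-identityʳ (𝕥 ^ b) ⟩
        𝕥 ^ b                    ∎
        where open import Relation.Binary.Reasoning.Setoid (CommutativeRing.setoid ring)
      a≡b : a ≡ b
      a≡b with a ≟ b
      ... | yes a≡b = a≡b
      ... | no a≢b = ⊥-elim (ℚ.1≢0 (trans (sym (𝕥^-top a)) (trans (𝕥^a≈𝕥^b a) (trans (𝕥^-coeff b a) (cong fromℕ (δ-off (λ b≡a → a≢b (sym b≡a))))))))
        where
        𝕥^-top : ∀ n → (𝕥 ^ n) n ≡ 1ℚ
        𝕥^-top n = trans (𝕥^-coeff n n) (trans (cong fromℕ (δ-diag n)) (ℚ.+-identityʳ 1ℚ))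

  mutual
    leaves : Tree → ℕ
    leaves (node []) = 1
    leaves (node (c ∷ cs)) = leavesF (c ∷ cs)

    leavesF : Forest → ℕ
    leavesF [] = 0
    leavesF (t ∷ ts) = leaves t + leavesF ts

  leaves-positive : ∀ T → 0 < leaves T
  leaves-positive (node []) = s≤s z≤n
  leaves-positive (node (c ∷ cs)) = ℕ.≤-trans (leaves-positive c) (ℕ.m≤m+n (leaves c) (leavesF cs))

  rootIfLeaf-split : ∀ p → map rootIfLeaf p ↭ y⁰-part p ++ map (raiseX ∘ raiseY) (y-quotient p)
  rootIfLeaf-split [] = ↭-refl
  rootIfLeaf-split ((a , zero) ∷ p) = ↭-prep (a , zero) (rootIfLeaf-split p)
  rootIfLeaf-split ((a , suc b) ∷ p) =
    ↭-trans (↭-prep (suc a , suc b) (rootIfLeaf-split p)) (↭-sym (↭-shift (suc a , suc b) (y⁰-part p) _))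

  rootIfLeaf-injective : ∀ m m′ → rootIfLeaf m ≡ rootIfLeaf m′ → m ≡ m′
  rootIfLeaf-injective (a , zero) (.a , zero) refl = refl
  rootIfLeaf-injective (a , suc b) (.a , suc .b) refl = refl

  -- Evaluated, rootIfLeaf is p ↦ p(x, 0) + x (p - p(x, 0)).
  ev-rootIfLeaf : ∀ {X Y} p → ev X Y (map rootIfLeaf p) ⊕ X ⊛ ev X 0S p ≈ ev X 0S p ⊕ X ⊛ ev X Y p
  ev-rootIfLeaf {X} {Y} p = begin
      ev X Y (map rootIfLeaf p) ⊕ X ⊛ ev X 0S p
    ≈⟨ ⊕-cong (≈-trans (ev-↭ (rootIfLeaf-split p)) (≈-trans (ev-++ (y⁰-part p) _) (⊕-congˡ P₀ raised)))
              (⊛-congˡ X (≈-sym (ev-at-y=0 p))) ⟩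
      P₀ ⊕ X ⊛ (Y ⊛ Q) ⊕ X ⊛ P₀
    ≈⟨ solve 4 (λ p₀ x y q → p₀ :+ x :* (y :* q) :+ x :* p₀ := p₀ :+ x :* (p₀ :+ y :* q)) ≈-refl P₀ X Y Q ⟩
      P₀ ⊕ X ⊛ (P₀ ⊕ Y ⊛ Q)
    ≈⟨ ⊕-cong (ev-at-y=0 p) (⊛-congˡ X (≈-sym (ev-split p))) ⟩
      ev X 0S p ⊕ X ⊛ ev X Y p ∎
    where
    open import Relation.Binary.Reasoning.Setoid (CommutativeRing.setoid ring)
    open SeriesSolver using (solve; _:=_; _:+_; _:*_)
    P₀ = ev X Y (y⁰-part p)
    Q = ev X Y (y-quotient p)
    raised : ev X Y (map (raiseX ∘ raiseY) (y-quotient p)) ≈ X ⊛ (Y ⊛ Q)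
    raised = ≈-trans (ev-map (raiseX ∘ raiseY) (X ⊛ Y)
                       (λ (a , b) → solve 4 (λ x p y q → (x :* p) :* (y :* q) := (x :* y) :* (p :* q)) ≈-refl X (X ^ a) Y (Y ^ b))
                       (y-quotient p))
                     (⊛-assoc X Y Q)

  ev-PT-leaf : ∀ {X Y} → ev X Y (PT (node [])) ≈ 1S ⊕ X ⊛ Y
  ev-PT-leaf {X} {Y} = ⊕-cong (⊛-identityˡ 1S) (≈-trans (λ i → ℚ.+-identityʳ _) (⊛-cong (⊛-identityʳ X) (⊛-identityʳ Y)))

  mutual
    PT-at-y=0 : ∀ {X} T → ev X 0S (PT T) ≈ 1S
    PT-at-y=0 {X} (node []) = ≈-trans ev-PT-leaf (≈-trans (⊕-congˡ 1S (⊛-zeroʳ X)) (λ i → ℚ.+-identityʳ _))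
    PT-at-y=0 {X} (node (c ∷ cs)) =
      ≈-trans (⊕-cancelʳ (X ⊛ ev X 0S (PF (c ∷ cs))) _ _ (ev-rootIfLeaf (PF (c ∷ cs)))) (PF-at-y=0 (c ∷ cs))

    PF-at-y=0 : ∀ {X} F → ev X 0S (PF F) ≈ 1S
    PF-at-y=0 {X} [] = ev-one {X} {0S}
    PF-at-y=0 {X} (t ∷ ts) =
      ≈-trans (ev-mul (PT t) (PF ts)) (≈-trans (⊛-cong (PT-at-y=0 t) (PF-at-y=0 ts)) (⊛-identityˡ 1S))

  ev-PT-node : ∀ {X Y} c cs → ev X Y (PT (node (c ∷ cs))) ⊕ X ≈ 1S ⊕ X ⊛ ev X Y (PF (c ∷ cs))
  ev-PT-node {X} {Y} c cs = begin
      ev X Y (PT (node (c ∷ cs))) ⊕ X                ≈⟨ ⊕-congˡ (ev X Y (PT (node (c ∷ cs)))) (≈-trans (≈-sym (⊛-identityʳ X)) (⊛-congˡ X (≈-sym (PF-at-y=0 (c ∷ cs))))) ⟩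
      ev X Y (PT (node (c ∷ cs))) ⊕ X ⊛ ev X 0S p    ≈⟨ ev-rootIfLeaf p ⟩
      ev X 0S p ⊕ X ⊛ ev X Y p                       ≈⟨ ⊕-congʳ (X ⊛ ev X Y p) (PF-at-y=0 (c ∷ cs)) ⟩
      1S ⊕ X ⊛ ev X Y p                              ∎
    where
    open import Relation.Binary.Reasoning.Setoid (CommutativeRing.setoid ring)
    p = PF (c ∷ cs)

  mutual
    PT-at-x=1 : ∀ T → ev 1S 𝕫 (PT T) ≈ 𝕥 ^ leaves T
    PT-at-x=1 (node []) i = trans (ev-PT-leaf i)
      (trans (cong (1S i ℚ.+_) (⊛-identityˡ 𝕫 i))
      (trans (solve 2 (λ o t → o :+ (t :+ :- o) := t) refl (1S i) (𝕥 i)) (sym (⊛-identityʳ 𝕥 i))))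
      where open +-*-Solver
    PT-at-x=1 (node (c ∷ cs)) =
      ≈-trans (⊕-cancelʳ 1S _ _ (≈-trans (ev-PT-node c cs) (≈-trans (⊕-congˡ 1S (⊛-identityˡ _)) (⊕-comm 1S _))))
              (PF-at-x=1 (c ∷ cs))
      where open CommutativeRing ring using () renaming (+-comm to ⊕-comm)

    PF-at-x=1 : ∀ F → ev 1S 𝕫 (PF F) ≈ 𝕥 ^ leavesF F
    PF-at-x=1 [] = ev-one {1S} {𝕫}
    PF-at-x=1 (t ∷ ts) = ≈-trans (ev-mul (PT t) (PF ts))
      (≈-trans (⊛-cong (PT-at-x=1 t) (PF-at-x=1 ts)) (≈-sym (^-homo-* 𝕥 (leaves t) (leavesF ts))))

  ev-PT-node-1⊖ : ∀ c cs a → ev (1⊖ a) 𝕫 (PT (node (c ∷ cs))) ≈ 1S ⊕ (1⊖ a) ⊛ (ev (1⊖ a) 𝕫 (PF (c ∷ cs)) ⊕ ⊝ 1S)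
  ev-PT-node-1⊖ c cs a i = begin
      E i                                  ≡⟨ solve 2 (λ e x → e := e :+ x :- x) refl (E i) (X i) ⟩
      E i ℚ.+ X i ℚ.- X i                  ≡⟨ cong (ℚ._- X i) (ev-PT-node c cs i) ⟩
      1S i ℚ.+ (X ⊛ W) i ℚ.- X i           ≡⟨ solve 3 (λ o y x → o :+ y :- x := o :+ (y :+ :- x)) refl (1S i) ((X ⊛ W) i) (X i) ⟩
      1S i ℚ.+ ((X ⊛ W) i ℚ.+ ℚ.- X i)     ≡⟨ cong (1S i ℚ.+_) (X⊛[W-1] i) ⟨
      1S i ℚ.+ (X ⊛ (W ⊕ ⊝ 1S)) i          ∎
    where
    open ≡-Reasoning
    open +-*-Solver
    open import Algebra.Properties.Ring (CommutativeRing.ring ring) using (-‿distribʳ-*)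
    X = 1⊖ a
    E = ev X 𝕫 (PT (node (c ∷ cs)))
    W = ev X 𝕫 (PF (c ∷ cs))
    X⊛[W-1] : X ⊛ (W ⊕ ⊝ 1S) ≈ X ⊛ W ⊕ ⊝ X
    X⊛[W-1] = ≈-trans (⊛-distribˡ X W (⊝ 1S)) (⊕-congˡ (X ⊛ W) (≈-trans (≈-sym (-‿distribʳ-* X 1S)) (⊝-cong (⊛-identityʳ X))))

  linear-1⊖ : HasLinearPart 1⊖_ (0ℚ ℚ.+ ℚ.- 1ℚ) (1ℚ ℚ.+ 0ℚ)
  linear-1⊖ = linear-⊕ (linear-const 1S) linear-neg

  forest-constant : Forest → ℚ
  forest-constant [] = 1ℚ
  forest-constant (_ ∷ _) = 0ℚ

  mutual
    PT-linear : ∀ T → Σ[ k ∈ ℕ ] HasLinearPart (λ a → ev (1⊖ a) 𝕫 (PT T)) (fromℕ (suc k)) 0ℚ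
    PT-linear (node []) = 0 , linear-ext (λ a → ≈-sym ev-PT-leaf)
      (linear-resp (solve 0 (con 0ℚ :+ ((con 1ℚ :+ con 0ℚ) :* con 0ℚ :+ (con 0ℚ :+ con (ℚ.- 1ℚ)) :* (con 0ℚ :+ con (ℚ.- 1ℚ)))
                               := con 1ℚ :+ con 0ℚ) refl)
                   (solve 0 (con 1ℚ :+ (con 1ℚ :+ con 0ℚ) :* (con 0ℚ :+ con (ℚ.- 1ℚ)) := con 0ℚ) refl)
                   (linear-⊕ (linear-const 1S) (linear-⊛ linear-1⊖ (linear-const 𝕫))))
      where open +-*-Solver
    PT-linear (node (c ∷ cs)) with k , L ← PF-linear (c ∷ cs) = k , linear-ext (λ a → ≈-sym (ev-PT-node-1⊖ c cs a))
      (linear-resp (solve 1 (λ q → con 0ℚ :+ ((con 1ℚ :+ con 0ℚ) :* (q :+ con 0ℚ) :+ (con 0ℚ :+ con (ℚ.- 1ℚ)) :* (con 0ℚ :+ con (ℚ.- 1ℚ)))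
                               := con 1ℚ :+ q) refl (fromℕ k))
                   (solve 0 (con 1ℚ :+ (con 1ℚ :+ con 0ℚ) :* (con 0ℚ :+ con (ℚ.- 1ℚ)) := con 0ℚ) refl)
                   (linear-⊕ (linear-const 1S) (linear-⊛ linear-1⊖ (linear-⊕ L (linear-const (⊝ 1S))))))
      where open +-*-Solver

    PF-linear : ∀ F → Σ[ k ∈ ℕ ] HasLinearPart (λ a → ev (1⊖ a) 𝕫 (PF F)) (fromℕ k) (forest-constant F)
    PF-linear [] = 0 , linear-ext (λ a → ≈-sym (ev-one {1⊖ a} {𝕫})) (linear-const 1S)
    PF-linear (t ∷ []) with k , L ← PT-linear t = suc k , linear-ext (λ a → ≈-sym (ev-mul (PT t) (PF [])))
      (linear-resp (solve 1 (λ q → con 0ℚ :* con 0ℚ :+ con 1ℚ :* q := q) refl (fromℕ (suc k)))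
                   (solve 0 (con 0ℚ :* con 1ℚ := con 0ℚ) refl)
                   (linear-⊛ L (proj₂ (PF-linear []))))
      where open +-*-Solver
    PF-linear (t ∷ t′ ∷ ts) with k , L ← PT-linear t | k′ , L′ ← PF-linear (t′ ∷ ts) =
      0 , linear-ext (λ a → ≈-sym (ev-mul (PT t) (PF (t′ ∷ ts))))
        (linear-resp (solve 2 (λ p q → con 0ℚ :* p :+ con 0ℚ :* q := con 0ℚ) refl (fromℕ k′) (fromℕ (suc k)))
                     (solve 0 (con 0ℚ :* con 0ℚ := con 0ℚ) refl)
                     (linear-⊛ L L′))
      where open +-*-Solver

  mutual
    PT-leading : ∀ T → Leading proj₂ (size T , leaves T) (PT T)
    PT-leading (node []) = leading ((0 , 0) ∷ []) (↭-swap (0 , 0) (1 , 1) ↭-refl) (s≤s z≤n ∷ [])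
    PT-leading (node (c ∷ cs)) with leading lo split lo< ← PF-leading (c ∷ cs) =
      leading (map rootIfLeaf lo)
              (↭-trans (map⁺ rootIfLeaf split) (↭-reflexive (cong (_∷ map rootIfLeaf lo) (top (leaves-positive (node (c ∷ cs)))))))
              (All.map⁺ (All.map (λ {m} → keeps-y m) lo<))
      where
      top : ∀ {v l} → 0 < l → rootIfLeaf (v , l) ≡ (suc v , l)
      top {l = suc _} _ = refl
      keeps-y : ∀ {L} m → proj₂ m < L → proj₂ (rootIfLeaf m) < L
      keeps-y (v , zero) m<L = m<L
      keeps-y (v , suc l) m<L = m<L

    PF-leading : ∀ F → Leading proj₂ (sizeF F , leavesF F) (PF F)
    PF-leading [] = leading [] ↭-refl []
    PF-leading (t ∷ ts) = Leading-mul proj₂ (λ _ _ → refl) (PT-leading t) (PF-leading ts)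

  private
    leaf≭node : ∀ c cs → ¬ (PT (node []) ↭ PT (node (c ∷ cs)))
    leaf≭node (node cs′) cs e with leading _ split _ ← PT-leading (node (node cs′ ∷ cs))
      with ∈-resp-↭ (↭-sym e) (∈-resp-↭ (↭-sym split) (here refl))
    ... | here ()
    ... | there (here ())

  PT-children : ∀ {cs ds} → PT (node cs) ↭ PT (node ds) → PF cs ↭ PF ds
  PT-children {[]} {[]} _ = ↭-refl
  PT-children {[]} {d ∷ ds} e = ⊥-elim (leaf≭node d ds e)
  PT-children {c ∷ cs} {[]} e = ⊥-elim (leaf≭node c cs (↭-sym e))
  PT-children {c ∷ cs} {d ∷ ds} e = map-injective-↭ (λ {m} {m′} → rootIfLeaf-injective m m′) e

  PT-node : ∀ {cs ds} → cs ≅F ds → PF cs ↭ PF ds → PT (node cs) ↭ PT (node ds)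
  PT-node {[]} {[]} _ _ = ↭-refl
  PT-node {[]} {_ ∷ _} cs≅ds _ = ⊥-elim (ℕ.0≢1+n (≅F-length cs≅ds))
  PT-node {_ ∷ _} {[]} cs≅ds _ = ⊥-elim (ℕ.0≢1+n (sym (≅F-length cs≅ds)))
  PT-node {_ ∷ _} {_ ∷ _} _ e = map⁺ rootIfLeaf e

  -- The root a of a ↦ P_T(1 - a, t - 1) vanishes to order ℓ(T), the number of leaves.
  PT-separating-point : ∀ T → SeparatingPoint PT leaves T
  PT-separating-point T = record
    { X = 1⊖ root
    ; Y = 𝕫
    ; vanishes = root-vanishes
    ; separates = λ T′ T′≤T T′≈0 →
        vanishing-Leading-≤ (proj₁ order) (proj₂ order) T′≤T (PT-leading T′) (PT-leading T)
                            T′≈0 root-vanishes (PT-at-y=0 T′) (PT-at-y=0 T)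
    }
    where
    open Root (fromℕ-suc≢0 (proj₁ (PT-linear T))) (proj₂ (PT-linear T))
    1⊖0≈1 : 1⊖ 0S ≈ 1S
    1⊖0≈1 i = ℚ.+-identityʳ (1S i)
    order : root ≈[ leaves T ] 0S × root (leaves T) ≢ 0ℚ
    order = root-order (leaves-positive T) (≈-trans (ev-cong 1⊖0≈1 ≈-refl (PT T)) (PT-at-x=1 T))

  PF-complete-invariant : ∀ F₁ F₂ → (PF F₁ ≈P PF F₂) ⇔ (F₁ ≅F F₂)
  PF-complete-invariant F₁ F₂ = mk⇔
    (λ e → complete F₁ F₂ (≈P⇒↭ (PF F₁) (PF F₂) e))
    (λ F₁≅F₂ → ↭⇒≈P (Π-resp-≅ F₁≅F₂))
    where
    open Invariance PT PF (λ _ _ → ↭-refl) PT-node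
    open Completeness PT PF ↭-refl (λ _ _ → ↭-refl) (λ T → Leading-nonzero (PT-leading T))
                      (λ {cs} {ds} → PT-children {cs} {ds}) leaves PT-separating-point

open SubtreePolynomial using (SFo-complete-invariant)
open LeafPolynomial using (PF-complete-invariant)

theorem5p1 : (F₁ F₂ : Forest) →
    ((PF F₁ ≈P PF F₂) ⇔ (F₁ ≅F F₂)) × ((SFo F₁ ≈P SFo F₂) ⇔ (F₁ ≅F F₂))
theorem5p1 F₁ F₂ = PF-complete-invariant F₁ F₂ , SFo-complete-invariant F₁ F₂
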